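{- Let $q$ and $t$ be non-empty patterns each of which ends in its largest entry, and for a positive integer $u$ let $i_u$ denote the increasing pattern $12\cdots u$. Then for all positive integers $n$, \[S_{n,132}\big((q\ominus t)\oplus i_u\big)=S_{n,132}\big((q\oplus i_u)\ominus t\big).\]
   Context: A pattern of length $k$ is a permutation $q=q_1\cdots q_k$ of $\{1,\dots,k\}$. A permutation $p=p_1\cdots p_n$ contains $q$ if there are indices $i_1<\cdots<i_k$ with $p_{i_t}<p_{i_u}$ iff $q_t<q_u$ for all $t,u$; each such subsequence is a copy of $q$; $p$ avoids $q$ if it contains no copy. $S_{n,r}(q)$ denotes the total number of copies of $q$ in all $r$-avoiding permutations of length $n$. For patterns $q$ of length $k$ and $t$ of length $m$: $q\oplus t$ is the pattern of length $k+m$ with $(q\oplus t)_i=q_i$ for $i\le k$ and $(q\oplus t)_i=t_{i-k}+k$ for $i>k$; $q\ominus t$ is the pattern of length $k+m$ with $(q\ominus t)_i=q_i+m$ for $i\le k$ and $(q\ominus t)_i=t_{i-k}$ for $i>k$. -}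

module Defs where

open import Data.Nat using (ℕ; zero; suc; _+_; _<ᵇ_; _≡ᵇ_)
open import Data.Bool using (Bool; true; false; _∧_; not; if_then_else_)
open import Data.List using (List; []; _∷_; _++_; map; length; filter; concatMap; zip; last)
open import Data.Nat.ListAction using (sum)
open import Data.Bool.ListAction using (all)
open import Data.List.Base using (upTo)
open import Data.Maybe using (Maybe; just)
open import Relation.Binary.PropositionalEquality using (_≡_)
open import Data.Bool.Properties using (T?)

-- A pattern / permutation is a list of positive naturals p₁ ⋯ pₖ (one-line notation).

oneTo : ℕ → List ℕ
oneTo n = map suc (upTo n)

occ : ℕ → List ℕ → ℕ
occ x [] = 0
occ x (y ∷ ys) = if x ≡ᵇ y then suc (occ x ys) else occ x ys

isPerm : List ℕ → Bool
isPerm p = all (λ i → occ i p ≡ᵇ 1) (oneTo (length p))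

IsPerm : List ℕ → Set
IsPerm p = isPerm p ≡ true

_==ᵇ_ : Bool → Bool → Bool
true ==ᵇ b = b
false ==ᵇ b = not b

orderIso : List ℕ → List ℕ → Bool
orderIso [] [] = true
orderIso [] (_ ∷ _) = false
orderIso (_ ∷ _) [] = false
orderIso (a ∷ as) (b ∷ bs) =
  orderIso as bs ∧ (length as ≡ᵇ length bs) ∧
  all (λ cd → ((a <ᵇ Data.Product.proj₁ cd) ==ᵇ (b <ᵇ Data.Product.proj₂ cd))
            ∧ ((Data.Product.proj₁ cd <ᵇ a) ==ᵇ (Data.Product.proj₂ cd <ᵇ b)))
      (zip as bs)
  where import Data.Product

subseqs : List ℕ → List (List ℕ)
subseqs [] = [] ∷ []
subseqs (x ∷ xs) = map (x ∷_) (subseqs xs) ++ subseqs xs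

copies : List ℕ → List ℕ → ℕ
copies q p = length (filter (λ s → T? (orderIso q s)) (subseqs p))

avoids : List ℕ → List ℕ → Bool
avoids r p = copies r p ≡ᵇ 0

lists : ℕ → ℕ → List (List ℕ)
lists zero m = [] ∷ []
lists (suc n) m = concatMap (λ x → map (x ∷_) (lists n m)) (oneTo m)

perms : ℕ → List (List ℕ)
perms n = filter (λ p → T? (isPerm p)) (lists n n)

S : ℕ → List ℕ → List ℕ → ℕ
S n r q = sum (map (copies q) (filter (λ p → T? (avoids r p)) (perms n)))

_⊕_ : List ℕ → List ℕ → List ℕ
q ⊕ t = q ++ map (λ x → x + length q) t

_⊖_ : List ℕ → List ℕ → List ℕ
q ⊖ t = map (λ x → x + length t) q ++ t

inc : ℕ → List ℕ
inc u = oneTo u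

p132 : List ℕ
p132 = 1 ∷ 3 ∷ 2 ∷ []

EndsInMax : List ℕ → Set
EndsInMax q = last q ≡ just (length q)

-- Write S_σ for the series Σₖ S_{k,132}(σ) xᵏ and C for S_[] (the Catalan series). Cutting a 132-avoider
-- at its maximum, into α ⊖ β with the maximum in between, expresses S_σ through the splits σ = L ++ R with
-- L above R. For σ = σ′ z ending in its maximum only the two trivial splits survive, giving
-- S_σ = x (S_σ C + C S_σ) + x S_σ′ C. For a skew sum X ⊖ Y of two such patterns, X = X′ M, the split (X , Y)
-- survives as well, giving S_{X⊖Y} = x (S_{X⊖Y} C + C S_{X⊖Y}) + x (S_X + S_X′) S_Y. Each equation determines
-- its solution. Applied with X = q ⊕ i_w, whose last entry is its maximum, an induction on u shows that
-- S_{(q⊖t)⊕i_u} and S_{(q⊕i_u)⊖t} satisfy equations with equal right-hand sides.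

module Submission where

open import Defs
open import Data.Nat using (ℕ; zero; suc; _+_; _*_; _∸_; _≤_; _<_; z≤n; s≤s; s≤s⁻¹; _<ᵇ_; _≡ᵇ_; _≤?_; _<?_)
open import Data.Nat.Properties
open import Data.Nat.ListAction using (sum)
open import Data.Nat.ListAction.Properties using (sum-++; sum-↭)
open import Data.Nat.Tactic.RingSolver using (solve-∀)
import Algebra.Properties.CommutativeSemigroup +-commutativeSemigroup as +-CS
open import Data.Bool using (Bool; true; false; _∧_; not)
open import Data.Bool.Properties using (T?; T-≡; ∧-zeroʳ; ∧-identityʳ)
open import Data.Bool.ListAction using (all)
open import Data.List using (List; []; _∷_; _++_; map; length; filter; concatMap; concat; zip; applyUpTo; upTo; last)
open import Data.List.Properties
  using ( map-++; map-∘; map-upTo; map-injective; length-++; length-map; ++-assoc; ++-identityʳ; ++-cancelˡ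
        ; ∷-injectiveˡ; ∷-injectiveʳ; applyUpTo-∷ʳ; length-applyUpTo)
open import Data.List.Relation.Unary.All using (All; []; _∷_)
import Data.List.Relation.Unary.All as All
import Data.List.Relation.Unary.All.Properties as All
open import Data.List.Relation.Unary.Any using (here; there)
import Data.List.Relation.Unary.Any as Any
open import Data.List.Relation.Unary.AllPairs using ([]; _∷_)
open import Data.List.Relation.Unary.Unique.Propositional using (Unique)
import Data.List.Relation.Unary.Unique.Propositional.Properties as Unique
open import Data.List.Membership.Propositional using (_∈_; find)
open import Data.List.Membership.Propositional.Properties
open import Data.List.Membership.Propositional.Properties.WithK using (unique∧set⇒bag)
open import Data.List.Relation.Binary.BagAndSetEquality using (∼bag⇒↭)
open import Data.List.Relation.Binary.Permutation.Propositional using (_↭_)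
import Data.List.Relation.Binary.Permutation.Propositional.Properties as Perm
open import Data.Maybe using (just)
open import Data.Product using (Σ; _×_; _,_; proj₁; proj₂)
open import Data.Sum using (inj₁; inj₂)
open import Data.Empty using (⊥-elim)
open import Function using (_∘_; id; _⇔_; mk⇔; Equivalence)
open import Relation.Nullary using (yes; no)
open import Relation.Binary.PropositionalEquality

private variable A B : Set

∑ : {A : Set} → List A → (A → ℕ) → ℕ
∑ xs f = sum (map f xs)

syntax ∑ xs (λ x → e) = ∑[ x ∈ xs ] e

∑-map : ∀ (g : A → B) xs f → ∑ (map g xs) f ≡ ∑ xs (f ∘ g)
∑-map g xs f = cong sum (sym (map-∘ xs))

∑-++ : ∀ (xs ys : List A) f → ∑ (xs ++ ys) f ≡ ∑ xs f + ∑ ys f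
∑-++ xs ys f = trans (cong sum (map-++ f xs ys)) (sum-++ (map f xs) (map f ys))

∑-concat : ∀ (xss : List (List A)) f → ∑ (concat xss) f ≡ ∑ xss (λ xs → ∑ xs f)
∑-concat [] f = refl
∑-concat (xs ∷ xss) f = trans (∑-++ xs (concat xss) f) (cong (∑ xs f +_) (∑-concat xss f))

∑-concatMap : ∀ (g : B → List A) ys f → ∑ (concatMap g ys) f ≡ ∑ ys (λ y → ∑ (g y) f)
∑-concatMap g ys f = trans (∑-concat (map g ys) f) (∑-map g ys _)

∑-cong-local : ∀ {f g : A → ℕ} xs → (∀ {x} → x ∈ xs → f x ≡ g x) → ∑ xs f ≡ ∑ xs g
∑-cong-local [] e = refl
∑-cong-local (x ∷ xs) e = cong₂ _+_ (e (here refl)) (∑-cong-local xs (e ∘ there))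

∑-cong : ∀ {f g : A → ℕ} xs → f ≗ g → ∑ xs f ≡ ∑ xs g
∑-cong xs e = ∑-cong-local xs (λ {x} _ → e x)

∑-zero : ∀ (xs : List A) {f} → f ≗ (λ _ → 0) → ∑ xs f ≡ 0
∑-zero [] e = refl
∑-zero (x ∷ xs) e rewrite e x = ∑-zero xs e

∑-+ : ∀ xs (f g : A → ℕ) → ∑[ x ∈ xs ] (f x + g x) ≡ ∑ xs f + ∑ xs g
∑-+ [] f g = refl
∑-+ (x ∷ xs) f g rewrite ∑-+ xs f g = +-CS.interchange (f x) (g x) (∑ xs f) (∑ xs g)

∑-*ˡ : ∀ xs a (f : A → ℕ) → ∑[ x ∈ xs ] (a * f x) ≡ a * ∑ xs f
∑-*ˡ [] a f = sym (*-zeroʳ a)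
∑-*ˡ (x ∷ xs) a f = trans (cong (a * f x +_) (∑-*ˡ xs a f)) (sym (*-distribˡ-+ a (f x) _))

∑-*ʳ : ∀ xs a (f : A → ℕ) → ∑[ x ∈ xs ] (f x * a) ≡ ∑ xs f * a
∑-*ʳ xs a f = trans (∑-cong xs (λ x → *-comm (f x) a)) (trans (∑-*ˡ xs a f) (*-comm a _))

∑-swap : ∀ xs (ys : List B) (f : A → B → ℕ) →
  ∑[ x ∈ xs ] ∑[ y ∈ ys ] f x y ≡ ∑[ y ∈ ys ] ∑[ x ∈ xs ] f x y
∑-swap [] ys f = sym (∑-zero ys (λ _ → refl))
∑-swap (x ∷ xs) ys f rewrite ∑-swap xs ys f = sym (∑-+ ys (f x) _)

∈⇒≤∑ : ∀ {x xs} (f : A → ℕ) → x ∈ xs → f x ≤ ∑ xs f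
∈⇒≤∑ {xs = y ∷ xs} f (here refl) = m≤m+n (f y) (∑ xs f)
∈⇒≤∑ {xs = y ∷ xs} f (there x∈) = ≤-trans (∈⇒≤∑ f x∈) (m≤n+m _ (f y))

∑-mono-≤ : ∀ xs {f g : A → ℕ} → (∀ x → f x ≤ g x) → ∑ xs f ≤ ∑ xs g
∑-mono-≤ [] h = z≤n
∑-mono-≤ (x ∷ xs) h = +-mono-≤ (h x) (∑-mono-≤ xs h)

∑∑-* : ∀ a (xs : List A) (ys : List B) f g → ∑[ x ∈ xs ] ∑[ y ∈ ys ] (a * f x * g y) ≡ a * ∑ xs f * ∑ ys g
∑∑-* a xs ys f g = begin
  ∑[ x ∈ xs ] ∑[ y ∈ ys ] (a * f x * g y)  ≡⟨ ∑-cong xs (λ x → ∑-*ˡ ys (a * f x) g) ⟩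
  ∑[ x ∈ xs ] (a * f x * ∑ ys g)           ≡⟨ ∑-*ʳ xs (∑ ys g) (λ x → a * f x) ⟩
  ∑[ x ∈ xs ] (a * f x) * ∑ ys g           ≡⟨ cong (_* ∑ ys g) (∑-*ˡ xs a f) ⟩
  a * ∑ xs f * ∑ ys g                      ∎
  where open ≡-Reasoning

∑-↭ : ∀ {xs ys : List A} (f : A → ℕ) → xs ↭ ys → ∑ xs f ≡ ∑ ys f
∑-↭ f p = sum-↭ (Perm.map⁺ f p)

∑-unique-⇔ : ∀ {xs ys : List A} (f : A → ℕ) → Unique xs → Unique ys → (∀ {x} → x ∈ xs ⇔ x ∈ ys) → ∑ xs f ≡ ∑ ys f
∑-unique-⇔ f ux uy xs⇔ys = ∑-↭ f (∼bag⇒↭ (unique∧set⇒bag ux uy xs⇔ys))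

⟦_⟧ : Bool → ℕ
⟦ true ⟧ = 1
⟦ false ⟧ = 0

⟦∧⟧ : ∀ a b → ⟦ a ∧ b ⟧ ≡ ⟦ a ⟧ * ⟦ b ⟧
⟦∧⟧ true b = sym (+-identityʳ ⟦ b ⟧)
⟦∧⟧ false b = refl

length-filter : ∀ (b : A → Bool) xs → length (filter (T? ∘ b) xs) ≡ ∑[ x ∈ xs ] ⟦ b x ⟧
length-filter b [] = refl
length-filter b (x ∷ xs) with b x
... | true = cong suc (length-filter b xs)
... | false = length-filter b xs

∑-1≡length : ∀ (xs : List A) → ∑[ x ∈ xs ] 1 ≡ length xs
∑-1≡length [] = refl
∑-1≡length (x ∷ xs) = cong suc (∑-1≡length xs)

-- Convolution of sequences

Seq : Set
Seq = ℕ → ℕ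

infixl 7 _⋆_
infixl 6 _⊞_

_⋆_ : Seq → Seq → Seq
(f ⋆ g) n = sum (applyUpTo (λ k → f k * g (n ∸ k)) (suc n))

_⊞_ : Seq → Seq → Seq
(f ⊞ g) n = f n + g n

shift : Seq → Seq
shift h zero = 0
shift h (suc n) = h n

⋆-∑ : ∀ f g n → (f ⋆ g) n ≡ ∑[ k ∈ upTo (suc n) ] (f k * g (n ∸ k))
⋆-∑ f g n = sym (cong sum (map-upTo _ (suc n)))

⋆-sucʳ : ∀ f g n → (f ⋆ g) (suc n) ≡ (f ⋆ (g ∘ suc)) n + f (suc n) * g 0
⋆-sucʳ f g zero = lemma (f 0 * g 1) (f 1 * g 0)
  where
  lemma : ∀ a b → a + (b + 0) ≡ (a + 0) + b
  lemma = solve-∀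
⋆-sucʳ f g (suc n) rewrite ⋆-sucʳ (f ∘ suc) g n =
  sym (+-assoc (f 0 * g (suc (suc n))) ((f ∘ suc ⋆ g ∘ suc) n) _)

⋆-comm : ∀ f g n → (f ⋆ g) n ≡ (g ⋆ f) n
⋆-comm f g zero = cong (_+ 0) (*-comm (f 0) (g 0))
⋆-comm f g (suc n) rewrite ⋆-sucʳ g f n | ⋆-comm (f ∘ suc) g n =
  trans (+-comm (f 0 * g (suc n)) _) (cong ((g ⋆ f ∘ suc) n +_) (*-comm (f 0) (g (suc n))))

⋆-cong-≤ : ∀ {f f′ g g′} n → (∀ {k} → k ≤ n → f k ≡ f′ k) → (∀ {k} → k ≤ n → g k ≡ g′ k) →
  (f ⋆ g) n ≡ (f′ ⋆ g′) n
⋆-cong-≤ zero ef eg = cong (_+ 0) (cong₂ _*_ (ef z≤n) (eg z≤n))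
⋆-cong-≤ (suc n) ef eg =
  cong₂ _+_ (cong₂ _*_ (ef z≤n) (eg ≤-refl)) (⋆-cong-≤ n (ef ∘ s≤s) (eg ∘ m≤n⇒m≤1+n))

⋆-cong : ∀ {f f′ g g′} → f ≗ f′ → g ≗ g′ → f ⋆ g ≗ f′ ⋆ g′
⋆-cong ef eg n = ⋆-cong-≤ n (λ {k} _ → ef k) (λ {k} _ → eg k)

⋆-congˡ : ∀ {f f′} g → f ≗ f′ → f ⋆ g ≗ f′ ⋆ g
⋆-congˡ {f} {f′} g ef = ⋆-cong {f} {f′} {g} {g} ef (λ _ → refl)

⋆-congʳ : ∀ f {g g′} → g ≗ g′ → f ⋆ g ≗ f ⋆ g′
⋆-congʳ f {g} {g′} eg = ⋆-cong {f} {f} {g} {g′} (λ _ → refl) eg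

⋆-distribʳ-⊞ : ∀ f f′ g n → ((f ⊞ f′) ⋆ g) n ≡ (f ⋆ g) n + (f′ ⋆ g) n
⋆-distribʳ-⊞ f f′ g zero = lemma (f 0) (f′ 0) (g 0)
  where
  lemma : ∀ a b c → (a + b) * c + 0 ≡ (a * c + 0) + (b * c + 0)
  lemma = solve-∀
⋆-distribʳ-⊞ f f′ g (suc n) rewrite ⋆-distribʳ-⊞ (f ∘ suc) (f′ ∘ suc) g n
  | *-distribʳ-+ (g (suc n)) (f 0) (f′ 0) = +-CS.interchange (f 0 * g (suc n)) _ _ _

⋆-distribˡ-⊞ : ∀ f g g′ n → (f ⋆ (g ⊞ g′)) n ≡ (f ⋆ g) n + (f ⋆ g′) n
⋆-distribˡ-⊞ f g g′ n = begin
  (f ⋆ (g ⊞ g′)) n        ≡⟨ ⋆-comm f (g ⊞ g′) n ⟩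
  ((g ⊞ g′) ⋆ f) n        ≡⟨ ⋆-distribʳ-⊞ g g′ f n ⟩
  (g ⋆ f) n + (g′ ⋆ f) n  ≡⟨ cong₂ _+_ (⋆-comm g f n) (⋆-comm g′ f n) ⟩
  (f ⋆ g) n + (f ⋆ g′) n  ∎
  where open ≡-Reasoning

⋆-scaleˡ : ∀ a f g n → ((λ k → a * f k) ⋆ g) n ≡ a * (f ⋆ g) n
⋆-scaleˡ a f g zero = lemma a (f 0) (g 0)
  where
  lemma : ∀ a b c → a * b * c + 0 ≡ a * (b * c + 0)
  lemma = solve-∀
⋆-scaleˡ a f g (suc n) rewrite ⋆-scaleˡ a (f ∘ suc) g n
  | *-assoc a (f 0) (g (suc n)) = sym (*-distribˡ-+ a _ _)

⋆-assoc : ∀ f g h n → ((f ⋆ g) ⋆ h) n ≡ (f ⋆ (g ⋆ h)) n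
⋆-assoc f g h zero = lemma (f 0) (g 0) (h 0)
  where
  lemma : ∀ a b c → (a * b + 0) * c + 0 ≡ a * (b * c + 0) + 0
  lemma = solve-∀
⋆-assoc f g h (suc n) = begin
  (f ⋆ g) 0 * h (suc n) + ((f ⋆ g) ∘ suc ⋆ h) n
    ≡⟨ cong ((f ⋆ g) 0 * h (suc n) +_) (⋆-distribʳ-⊞ (λ m → f 0 * g (suc m)) (f ∘ suc ⋆ g) h n) ⟩
  (f ⋆ g) 0 * h (suc n) + (((λ m → f 0 * g (suc m)) ⋆ h) n + ((f ∘ suc ⋆ g) ⋆ h) n)
    ≡⟨ cong₂ (λ x y → (f ⋆ g) 0 * h (suc n) + (x + y)) (⋆-scaleˡ (f 0) (g ∘ suc) h n) (⋆-assoc (f ∘ suc) g h n) ⟩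
  (f 0 * g 0 + 0) * h (suc n) + (f 0 * (g ∘ suc ⋆ h) n + (f ∘ suc ⋆ (g ⋆ h)) n)
    ≡⟨ lemma (f 0) (g 0) (h (suc n)) ((g ∘ suc ⋆ h) n) ((f ∘ suc ⋆ (g ⋆ h)) n) ⟩
  f 0 * (g 0 * h (suc n) + (g ∘ suc ⋆ h) n) + (f ∘ suc ⋆ (g ⋆ h)) n
    ∎
  where
  open ≡-Reasoning
  lemma : ∀ a b c x y → (a * b + 0) * c + (a * x + y) ≡ a * (b * c + x) + y
  lemma = solve-∀

⋆-right-comm : ∀ f g h → (f ⋆ g) ⋆ h ≗ (f ⋆ h) ⋆ g
⋆-right-comm f g h n = begin
  ((f ⋆ g) ⋆ h) n  ≡⟨ ⋆-assoc f g h n ⟩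
  (f ⋆ (g ⋆ h)) n  ≡⟨ ⋆-congʳ f (⋆-comm g h) n ⟩
  (f ⋆ (h ⋆ g)) n  ≡⟨ sym (⋆-assoc f h g n) ⟩
  ((f ⋆ h) ⋆ g) n  ∎
  where open ≡-Reasoning

shift-⊞ : ∀ f g → shift f ⊞ shift g ≗ shift (f ⊞ g)
shift-⊞ f g zero = refl
shift-⊞ f g (suc n) = refl

shift-⋆ : ∀ f g → shift f ⋆ g ≗ shift (f ⋆ g)
shift-⋆ f g zero = refl
shift-⋆ f g (suc n) = refl

⋆-shift : ∀ f g → f ⋆ shift g ≗ shift (f ⋆ g)
⋆-shift f g zero = trans (+-identityʳ (f 0 * 0)) (*-zeroʳ (f 0))
⋆-shift f g (suc n) = trans (⋆-comm f (shift g) (suc n)) (⋆-comm g f n)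

shift-cong : ∀ {f g} → f ≗ g → shift f ≗ shift g
shift-cong e zero = refl
shift-cong e (suc n) = e n

-- As power series, Solves X Z says X = x (X c + c X) + Z; the coefficient of xⁿ⁺¹ in X is fixed by
-- lower ones, so Z determines X.
module Recurrence (c : Seq) where

  record Solves (X Z : Seq) : Set where
    constructor solves
    field
      initial : X 0 ≡ Z 0
      step    : ∀ n → X (suc n) ≡ (X ⋆ c) n + (c ⋆ X) n + Z (suc n)

  Solves-unique : ∀ {X Y Z Z′} → Solves X Z → Solves Y Z′ → Z ≗ Z′ → X ≗ Y
  Solves-unique {X} {Y} (solves X0 Xsuc) (solves Y0 Ysuc) Z≗Z′ n = agree-up-to n ≤-refl
    where
    agree-up-to : ∀ n {k} → k ≤ n → X k ≡ Y k
    agree-up-to n {zero} _ = trans X0 (trans (Z≗Z′ 0) (sym Y0))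
    agree-up-to (suc n) {suc k} (s≤s k≤n) = begin
      X (suc k)                                  ≡⟨ Xsuc k ⟩
      (X ⋆ c) k + (c ⋆ X) k + _                  ≡⟨ cong₂ _+_ (cong₂ _+_ (⋆-cong-≤ {g = c} {c} k IH (λ _ → refl))
                                                                         (⋆-cong-≤ {c} {c} k (λ _ → refl) IH))
                                                              (Z≗Z′ (suc k)) ⟩
      (Y ⋆ c) k + (c ⋆ Y) k + _                  ≡⟨ sym (Ysuc k) ⟩
      Y (suc k)                                  ∎
      where
      open ≡-Reasoning
      IH : ∀ {j} → j ≤ k → X j ≡ Y j
      IH j≤k = agree-up-to n (≤-trans j≤k k≤n)

  Solves-respʳ : ∀ {X Z Z′} → Z ≗ Z′ → Solves X Z → Solves X Z′
  Solves-respʳ {X} Z≗Z′ (solves X0 Xsuc) =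
    solves (trans X0 (Z≗Z′ 0)) λ n → trans (Xsuc n) (cong ((X ⋆ c) n + (c ⋆ X) n +_) (Z≗Z′ (suc n)))

  Solves-⊞ : ∀ {X Y Z W} → Solves X Z → Solves Y W → Solves (X ⊞ Y) (Z ⊞ W)
  Solves-⊞ {X} {Y} {Z} {W} (solves X0 Xsuc) (solves Y0 Ysuc) = solves (cong₂ _+_ X0 Y0) λ n → begin
    X (suc n) + Y (suc n)
      ≡⟨ cong₂ _+_ (Xsuc n) (Ysuc n) ⟩
    ((X ⋆ c) n + (c ⋆ X) n + Z (suc n)) + ((Y ⋆ c) n + (c ⋆ Y) n + W (suc n))
      ≡⟨ lemma ((X ⋆ c) n) ((c ⋆ X) n) (Z (suc n)) ((Y ⋆ c) n) ((c ⋆ Y) n) (W (suc n)) ⟩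
    ((X ⋆ c) n + (Y ⋆ c) n) + ((c ⋆ X) n + (c ⋆ Y) n) + (Z (suc n) + W (suc n))
      ≡⟨ sym (cong (_+ (Z (suc n) + W (suc n))) (cong₂ _+_ (⋆-distribʳ-⊞ X Y c n) (⋆-distribˡ-⊞ c X Y n))) ⟩
    ((X ⊞ Y) ⋆ c) n + (c ⋆ (X ⊞ Y)) n + (Z ⊞ W) (suc n)
      ∎
    where
    open ≡-Reasoning
    lemma : ∀ a b z a′ b′ w → (a + b + z) + (a′ + b′ + w) ≡ (a + a′) + (b + b′) + (z + w)
    lemma = solve-∀

  Solves-⋆ : ∀ {X Z} y → Solves X Z → Solves (shift (X ⋆ y)) (shift (Z ⋆ y))
  Solves-⋆ {X} {Z} y (solves X0 Xsuc) = solves refl λ n → begin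
    (X ⋆ y) n
      ≡⟨ ⋆-congˡ y X-unfolded n ⟩
    ((shift (X ⋆ c) ⊞ shift (c ⋆ X) ⊞ Z) ⋆ y) n
      ≡⟨ trans (⋆-distribʳ-⊞ (shift (X ⋆ c) ⊞ shift (c ⋆ X)) Z y n)
               (cong (_+ (Z ⋆ y) n) (⋆-distribʳ-⊞ (shift (X ⋆ c)) (shift (c ⋆ X)) y n)) ⟩
    (shift (X ⋆ c) ⋆ y) n + (shift (c ⋆ X) ⋆ y) n + (Z ⋆ y) n
      ≡⟨ cong (λ t → t + (Z ⋆ y) n) (cong₂ _+_ (shift-⋆ (X ⋆ c) y n) (shift-⋆ (c ⋆ X) y n)) ⟩
    shift ((X ⋆ c) ⋆ y) n + shift ((c ⋆ X) ⋆ y) n + (Z ⋆ y) n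
      ≡⟨ cong (λ t → t + (Z ⋆ y) n) (cong₂ _+_ (shift-cong (⋆-right-comm X c y) n) (shift-cong (⋆-assoc c X y) n)) ⟩
    shift ((X ⋆ y) ⋆ c) n + shift (c ⋆ (X ⋆ y)) n + (Z ⋆ y) n
      ≡⟨ cong (λ t → t + (Z ⋆ y) n) (sym (cong₂ _+_ (shift-⋆ (X ⋆ y) c n) (⋆-shift c (X ⋆ y) n))) ⟩
    (shift (X ⋆ y) ⋆ c) n + (c ⋆ shift (X ⋆ y)) n + (Z ⋆ y) n
      ∎
    where
    open ≡-Reasoning
    X-unfolded : X ≗ shift (X ⋆ c) ⊞ shift (c ⋆ X) ⊞ Z
    X-unfolded zero = X0
    X-unfolded (suc n) = Xsuc n

  -- If a w = b w, then x (a w c) and x ((g (w + 2) + g (w + 1)) f), the terms driving a (w + 1) and b (w + 1),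
  -- solve equations with the same driving term.
  solutions-agree : ∀ (f : Seq) (g a b : ℕ → Seq) →
    (∀ w → Solves (g (suc w)) (shift (g w ⋆ c))) →
    (∀ w → Solves (b w) (shift ((g (suc w) ⊞ g w) ⋆ f))) →
    (∀ w → Solves (a (suc w)) (shift (a w ⋆ c))) →
    a 0 ≗ b 0 → ∀ w → a w ≗ b w
  solutions-agree f g a b G B A a₀≗b₀ zero = a₀≗b₀
  solutions-agree f g a b G B A a₀≗b₀ (suc w) = Solves-unique (A w) (B (suc w)) drivers-agree
    where
    E = g (suc w) ⊞ g w
    b⋆c-solves : Solves (shift (b w ⋆ c)) (shift (shift (E ⋆ f) ⋆ c))
    b⋆c-solves = Solves-⋆ c (B w)
    E′⋆f-solves : Solves (shift ((g (suc (suc w)) ⊞ g (suc w)) ⋆ f)) (shift ((shift (g (suc w) ⋆ c) ⊞ shift (g w ⋆ c)) ⋆ f))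
    E′⋆f-solves = Solves-⋆ f (Solves-⊞ (G (suc w)) (G w))
    same-driver : shift (E ⋆ f) ⋆ c ≗ (shift (g (suc w) ⋆ c) ⊞ shift (g w ⋆ c)) ⋆ f
    same-driver n = begin
      (shift (E ⋆ f) ⋆ c) n                               ≡⟨ shift-⋆ (E ⋆ f) c n ⟩
      shift ((E ⋆ f) ⋆ c) n                               ≡⟨ shift-cong (⋆-right-comm E f c) n ⟩
      shift ((E ⋆ c) ⋆ f) n                               ≡⟨ sym (shift-⋆ (E ⋆ c) f n) ⟩
      (shift (E ⋆ c) ⋆ f) n                               ≡⟨ ⋆-congˡ f (shift-cong (⋆-distribʳ-⊞ (g (suc w)) (g w) c)) n ⟩
      (shift (g (suc w) ⋆ c ⊞ g w ⋆ c) ⋆ f) n             ≡⟨ sym (⋆-congˡ f (shift-⊞ (g (suc w) ⋆ c) (g w ⋆ c)) n) ⟩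
      ((shift (g (suc w) ⋆ c) ⊞ shift (g w ⋆ c)) ⋆ f) n   ∎
      where open ≡-Reasoning
    drivers-agree : shift (a w ⋆ c) ≗ shift ((g (suc (suc w)) ⊞ g (suc w)) ⋆ f)
    drivers-agree n = trans (shift-cong (⋆-congˡ c (solutions-agree f g a b G B A a₀≗b₀ w)) n)
                            (Solves-unique b⋆c-solves E′⋆f-solves (shift-cong same-driver) n)

splits : List A → List (List A × List A)
splits [] = ([] , []) ∷ []
splits (x ∷ xs) = ([] , x ∷ xs) ∷ map (λ (L , R) → x ∷ L , R) (splits xs)

∈-splits⇒++ : ∀ (xs : List A) {L R} → (L , R) ∈ splits xs → L ++ R ≡ xs
∈-splits⇒++ [] (here refl) = refl
∈-splits⇒++ (x ∷ xs) (here refl) = refl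
∈-splits⇒++ (x ∷ xs) (there LR∈) with ∈-map⁻ (λ (L , R) → x ∷ L , R) LR∈
... | _ , LR∈′ , refl = cong (x ∷_) (∈-splits⇒++ xs LR∈′)

-- The split (X , Y) of X ++ Y is counted once on each side of the right-hand side.
∑-splits-++ : ∀ {A : Set} (h : List A × List A → ℕ) X Y →
  ∑ (splits (X ++ Y)) h + h (X , Y) ≡
  ∑ (splits X) (λ (L , R) → h (L , R ++ Y)) + ∑ (splits Y) (λ (L , R) → h (X ++ L , R))
∑-splits-++ h [] Y = trans (+-comm (∑ (splits Y) h) (h ([] , Y))) (cong (_+ ∑ (splits Y) h) (sym (+-identityʳ _)))
∑-splits-++ {A} h (x ∷ X) Y = begin
  hd + ∑ (map (λ (L , R) → x ∷ L , R) (splits (X ++ Y))) h + h (x ∷ X , Y)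
    ≡⟨ cong (λ s → hd + s + h (x ∷ X , Y)) (∑-map _ (splits (X ++ Y)) h) ⟩
  hd + ∑ (splits (X ++ Y)) h′ + h′ (X , Y)
    ≡⟨ +-assoc hd _ _ ⟩
  hd + (∑ (splits (X ++ Y)) h′ + h′ (X , Y))
    ≡⟨ cong (hd +_) (∑-splits-++ h′ X Y) ⟩
  hd + (∑ (splits X) (λ (L , R) → h′ (L , R ++ Y)) + right)
    ≡⟨ sym (+-assoc hd _ right) ⟩
  hd + ∑ (splits X) (λ (L , R) → h′ (L , R ++ Y)) + right
    ≡⟨ cong (λ s → hd + s + right) (sym (∑-map _ (splits X) (λ (L , R) → h (L , R ++ Y)))) ⟩
  ∑ (splits (x ∷ X)) (λ (L , R) → h (L , R ++ Y)) + right
    ∎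
  where
  open ≡-Reasoning
  hd : ℕ
  hd = h ([] , x ∷ X ++ Y)
  right : ℕ
  right = ∑ (splits Y) (λ (L , R) → h (x ∷ X ++ L , R))
  h′ : List A × List A → ℕ
  h′ (L , R) = h (x ∷ L , R)

∑-splits-∷ʳ : ∀ (h : List A × List A → ℕ) xs z →
  ∑ (splits (xs ++ z ∷ [])) h ≡ ∑ (splits xs) (λ (L , R) → h (L , R ++ z ∷ [])) + h (xs ++ z ∷ [] , [])
∑-splits-∷ʳ h xs z = +-cancelʳ-≡ (h (xs , z ∷ [])) _ _ (begin
  ∑ (splits (xs ++ z ∷ [])) h + h (xs , z ∷ [])
    ≡⟨ ∑-splits-++ h xs (z ∷ []) ⟩
  s + (h (xs ++ [] , z ∷ []) + (h (xs ++ z ∷ [] , []) + 0))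
    ≡⟨ cong (λ L → s + (h (L , z ∷ []) + (h (xs ++ z ∷ [] , []) + 0))) (++-identityʳ xs) ⟩
  s + (h (xs , z ∷ []) + (h (xs ++ z ∷ [] , []) + 0))
    ≡⟨ lemma s (h (xs , z ∷ [])) (h (xs ++ z ∷ [] , [])) ⟩
  s + h (xs ++ z ∷ [] , []) + h (xs , z ∷ [])
    ∎)
  where
  open ≡-Reasoning
  s = ∑ (splits xs) (λ (L , R) → h (L , R ++ z ∷ []))
  lemma : ∀ a b c → a + (b + (c + 0)) ≡ a + c + b
  lemma = solve-∀

∑-splits-head : ∀ xs (h : List A × List A → ℕ) →
  (∀ {x L R} → x ∷ L ++ R ≡ xs → h (x ∷ L , R) ≡ 0) → ∑ (splits xs) h ≡ h ([] , xs)
∑-splits-head [] h vanish = +-identityʳ _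
∑-splits-head (x ∷ xs) h vanish = begin
  h ([] , x ∷ xs) + ∑ (map (λ (L , R) → x ∷ L , R) (splits xs)) h
    ≡⟨ cong (h ([] , x ∷ xs) +_) (∑-map _ (splits xs) h) ⟩
  h ([] , x ∷ xs) + ∑ (splits xs) (λ (L , R) → h (x ∷ L , R))
    ≡⟨ cong (h ([] , x ∷ xs) +_) (trans (∑-cong-local (splits xs) λ LR∈ → vanish (cong (x ∷_) (∈-splits⇒++ xs LR∈)))
                                        (∑-zero (splits xs) (λ _ → refl))) ⟩
  h ([] , x ∷ xs) + 0
    ≡⟨ +-identityʳ _ ⟩
  h ([] , x ∷ xs)
    ∎
  where open ≡-Reasoning

∑-splits-last : ∀ xs (h : List A × List A → ℕ) →
  (∀ {L x R} → L ++ x ∷ R ≡ xs → h (L , x ∷ R) ≡ 0) → ∑ (splits xs) h ≡ h (xs , [])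
∑-splits-last [] h vanish = +-identityʳ _
∑-splits-last (x ∷ xs) h vanish = trans (cong (_+ ∑ (map (λ (L , R) → x ∷ L , R) (splits xs)) h) (vanish {[]} refl))
  (trans (∑-map _ (splits xs) h) (∑-splits-last xs (λ (L , R) → h (x ∷ L , R)) (λ e → vanish (cong (x ∷_) e))))

≡ᵇ-refl : ∀ n → (n ≡ᵇ n) ≡ true
≡ᵇ-refl zero = refl
≡ᵇ-refl (suc n) = ≡ᵇ-refl n

<⇒<ᵇ≡true : ∀ {a b} → a < b → (a <ᵇ b) ≡ true
<⇒<ᵇ≡true {zero} {suc b} _ = refl
<⇒<ᵇ≡true {suc a} {suc b} (s≤s a<b) = <⇒<ᵇ≡true a<b

≥⇒<ᵇ≡false : ∀ {a b} → b ≤ a → (a <ᵇ b) ≡ false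
≥⇒<ᵇ≡false {a} {zero} _ = refl
≥⇒<ᵇ≡false {suc a} {suc b} (s≤s b≤a) = ≥⇒<ᵇ≡false b≤a

<ᵇ-+ʳ : ∀ c a b → (a + c <ᵇ b + c) ≡ (a <ᵇ b)
<ᵇ-+ʳ c a b rewrite +-comm a c | +-comm b c = <ᵇ-+ˡ c
  where
  <ᵇ-+ˡ : ∀ c → (c + a <ᵇ c + b) ≡ (a <ᵇ b)
  <ᵇ-+ˡ zero = refl
  <ᵇ-+ˡ (suc c) = <ᵇ-+ˡ c

all-++ : ∀ (f : A → Bool) xs ys → all f (xs ++ ys) ≡ all f xs ∧ all f ys
all-++ f [] ys = refl
all-++ f (x ∷ xs) ys rewrite all-++ f xs ys with f x
... | true = refl
... | false = refl

zip-++ : ∀ (xs : List A) (ys : List B) {xs′ ys′} → length xs ≡ length ys →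
  zip (xs ++ xs′) (ys ++ ys′) ≡ zip xs ys ++ zip xs′ ys′
zip-++ [] [] _ = refl
zip-++ (x ∷ xs) (y ∷ ys) e = cong ((x , y) ∷_) (zip-++ xs ys (suc-injective e))

≡ᵇ-true⇒≡ : ∀ {m n} → (m ≡ᵇ n) ≡ true → m ≡ n
≡ᵇ-true⇒≡ {m} {n} e = ≡ᵇ⇒≡ m n (Equivalence.from T-≡ e)

all-true⁻ : ∀ (f : A → Bool) xs → all f xs ≡ true → All (λ x → f x ≡ true) xs
all-true⁻ f [] _ = []
all-true⁻ f (x ∷ xs) e with f x in fx
... | true = fx ∷ all-true⁻ f xs e

all-true⁺ : ∀ (f : A → Bool) {xs} → All (λ x → f x ≡ true) xs → all f xs ≡ true
all-true⁺ f [] = refl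
all-true⁺ f (fx ∷ fxs) rewrite fx = all-true⁺ f fxs

all-false : ∀ (f : ℕ → Bool) {R z} → z ∈ R → f z ≡ false → all f R ≡ false
all-false f {r ∷ R} (here refl) fz rewrite fz = refl
all-false f {r ∷ R} (there z∈) fz rewrite all-false f z∈ fz = ∧-zeroʳ (f r)

≢⇒≡ᵇ≡false : ∀ {i a} → i ≢ a → (i ≡ᵇ a) ≡ false
≢⇒≡ᵇ≡false {zero} {zero} i≢a = ⊥-elim (i≢a refl)
≢⇒≡ᵇ≡false {zero} {suc a} _ = refl
≢⇒≡ᵇ≡false {suc i} {zero} _ = refl
≢⇒≡ᵇ≡false {suc i} {suc a} i≢a = ≢⇒≡ᵇ≡false (i≢a ∘ cong suc)

≡ᵇ-+ʳ : ∀ m j a → (j + m ≡ᵇ a + m) ≡ (j ≡ᵇ a)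
≡ᵇ-+ʳ m j a rewrite +-comm j m | +-comm a m = ≡ᵇ-+ˡ m
  where
  ≡ᵇ-+ˡ : ∀ m → (m + j ≡ᵇ m + a) ≡ (j ≡ᵇ a)
  ≡ᵇ-+ˡ zero = refl
  ≡ᵇ-+ˡ (suc m) = ≡ᵇ-+ˡ m

occ-++ : ∀ i x y → occ i (x ++ y) ≡ occ i x + occ i y
occ-++ i [] y = refl
occ-++ i (a ∷ x) y with i ≡ᵇ a
... | true = cong suc (occ-++ i x y)
... | false = occ-++ i x y

occ-self : ∀ a xs → occ a (a ∷ xs) ≡ suc (occ a xs)
occ-self a xs rewrite ≡ᵇ-refl a = refl

occ-skip : ∀ {i a} xs → i ≢ a → occ i (a ∷ xs) ≡ occ i xs
occ-skip xs i≢a rewrite ≢⇒≡ᵇ≡false i≢a = refl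

occ-absent : ∀ {i xs} → All (i ≢_) xs → occ i xs ≡ 0
occ-absent [] = refl
occ-absent {xs = _ ∷ xs} (i≢a ∷ i≢xs) = trans (occ-skip xs i≢a) (occ-absent i≢xs)

occ-shift : ∀ m j α → occ (j + m) (map (_+ m) α) ≡ occ j α
occ-shift m j [] = refl
occ-shift m j (a ∷ α) rewrite ≡ᵇ-+ʳ m j a with j ≡ᵇ a
... | true = cong suc (occ-shift m j α)
... | false = occ-shift m j α

occ≡suc⇒∈ : ∀ {i c} xs → occ i xs ≡ suc c → i ∈ xs
occ≡suc⇒∈ {i} (a ∷ xs) e with i ≡ᵇ a in i≡ᵇa
... | true = here (≡ᵇ-true⇒≡ i≡ᵇa)
... | false = there (occ≡suc⇒∈ xs e)

∈⇒occ≥1 : ∀ {i xs} → i ∈ xs → 1 ≤ occ i xs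
∈⇒occ≥1 {i} {_ ∷ xs} (here refl) rewrite occ-self i xs = s≤s z≤n
∈⇒occ≥1 {i} {a ∷ xs} (there i∈) with i ≡ᵇ a
... | true = s≤s z≤n
... | false = ∈⇒occ≥1 i∈

∈-++⇒occ≥2 : ∀ {a} u {v} → a ∈ u → a ∈ v → 2 ≤ occ a (u ++ v)
∈-++⇒occ≥2 {a} u {v} a∈u a∈v rewrite occ-++ a u v = +-mono-≤ (∈⇒occ≥1 a∈u) (∈⇒occ≥1 a∈v)

occ-∑ : ∀ i p → occ i p ≡ ∑[ a ∈ p ] ⟦ i ≡ᵇ a ⟧
occ-∑ i [] = refl
occ-∑ i (a ∷ p) with i ≡ᵇ a
... | true = cong suc (occ-∑ i p)
... | false = occ-∑ i p

≡ᵇ-sym : ∀ i a → (i ≡ᵇ a) ≡ (a ≡ᵇ i)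
≡ᵇ-sym zero zero = refl
≡ᵇ-sym zero (suc a) = refl
≡ᵇ-sym (suc i) zero = refl
≡ᵇ-sym (suc i) (suc a) = ≡ᵇ-sym i a

∈-++-insert : ∀ u {x v} {z : ℕ} → z ∈ u ++ v → z ∈ u ++ x ∷ v
∈-++-insert u z∈ with ∈-++⁻ u z∈
... | inj₁ z∈u = ∈-++⁺ˡ z∈u
... | inj₂ z∈v = ∈-++⁺ʳ u (there z∈v)

length-++-∷ : ∀ (u : List ℕ) z v → length (u ++ z ∷ v) ≡ suc (length (u ++ v))
length-++-∷ u z v rewrite length-++ u {z ∷ v} | length-++ u {v} = +-suc (length u) (length v)

occ-++-∷ : ∀ i (u : List ℕ) z v → occ i (u ++ z ∷ v) ≡ occ i (z ∷ []) + occ i (u ++ v)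
occ-++-∷ i u z v rewrite occ-++ i u (z ∷ v) | occ-++ i u v with i ≡ᵇ z
... | true = +-suc (occ i u) (occ i v)
... | false = refl

All-++-∷⁻ : ∀ {P : ℕ → Set} u {z v} → All P (u ++ z ∷ v) → P z × All P (u ++ v)
All-++-∷⁻ u h with All.++⁻ u h
... | hu , (hz ∷ hv) = hz , All.++⁺ hu hv

All-++-∷⁺ : ∀ {P : ℕ → Set} u {z v} → P z → All P (u ++ v) → All P (u ++ z ∷ v)
All-++-∷⁺ u hz h with All.++⁻ u h
... | hu , hv = All.++⁺ hu (hz ∷ hv)

-- The comparison test inside orderIso, spelled exactly as there so that `rewrite` can match it.
sameOrder : ℕ → ℕ → ℕ × ℕ → Bool
sameOrder a b cd = ((a <ᵇ proj₁ cd) ==ᵇ (b <ᵇ proj₂ cd)) ∧ ((proj₁ cd <ᵇ a) ==ᵇ (proj₂ cd <ᵇ b))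

orderIso⇒length≡ : ∀ σ s → orderIso σ s ≡ true → length σ ≡ length s
orderIso⇒length≡ [] [] _ = refl
orderIso⇒length≡ (x ∷ σ) (y ∷ s) e with orderIso σ s in eq
... | true = cong suc (orderIso⇒length≡ σ s eq)

all-sameOrder-shiftʳ : ∀ c x a σ s → all (sameOrder x (a + c)) (zip σ (map (_+ c) s)) ≡ all (sameOrder x a) (zip σ s)
all-sameOrder-shiftʳ c x a [] s = refl
all-sameOrder-shiftʳ c x a (y ∷ σ) [] = refl
all-sameOrder-shiftʳ c x a (y ∷ σ) (d ∷ s)
  rewrite all-sameOrder-shiftʳ c x a σ s | <ᵇ-+ʳ c a d | <ᵇ-+ʳ c d a = refl

all-sameOrder-shiftˡ : ∀ c x a σ s → all (sameOrder (x + c) a) (zip (map (_+ c) σ) s) ≡ all (sameOrder x a) (zip σ s)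
all-sameOrder-shiftˡ c x a [] s = refl
all-sameOrder-shiftˡ c x a (y ∷ σ) [] = refl
all-sameOrder-shiftˡ c x a (y ∷ σ) (d ∷ s)
  rewrite all-sameOrder-shiftˡ c x a σ s | <ᵇ-+ʳ c x y | <ᵇ-+ʳ c y x = refl

orderIso-shiftʳ : ∀ c σ s → orderIso σ (map (_+ c) s) ≡ orderIso σ s
orderIso-shiftʳ c [] [] = refl
orderIso-shiftʳ c [] (_ ∷ _) = refl
orderIso-shiftʳ c (_ ∷ _) [] = refl
orderIso-shiftʳ c (x ∷ σ) (a ∷ s)
  rewrite orderIso-shiftʳ c σ s | length-map (_+ c) s | all-sameOrder-shiftʳ c x a σ s = refl

orderIso-shiftˡ : ∀ c σ s → orderIso (map (_+ c) σ) s ≡ orderIso σ s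
orderIso-shiftˡ c [] [] = refl
orderIso-shiftˡ c [] (_ ∷ _) = refl
orderIso-shiftˡ c (_ ∷ _) [] = refl
orderIso-shiftˡ c (x ∷ σ) (a ∷ s)
  rewrite orderIso-shiftˡ c σ s | length-map (_+ c) σ | all-sameOrder-shiftˡ c x a σ s = refl

-- `stacked true x e` says e < x and `stacked false x e` says x < e, written in the shape that
-- `sameOrder x a (e , f)` takes once f < a (resp. a < f) is known.
stacked : Bool → ℕ → ℕ → Bool
stacked up x e = ((x <ᵇ e) ==ᵇ not up) ∧ ((e <ᵇ x) ==ᵇ up)

allStacked : Bool → List ℕ → List ℕ → Bool
allStacked up L R = all (λ x → all (stacked up x) R) L

stackedAbove : (List ℕ × List ℕ → ℕ) → List ℕ × List ℕ → ℕ
stackedAbove G (L , R) = ⟦ allStacked true L R ⟧ * G (L , R)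

AllStacked : Bool → List ℕ → List ℕ → Set
AllStacked up X Y = All (λ a → All (λ f → ((f <ᵇ a) ≡ up) × ((a <ᵇ f) ≡ not up)) Y) X

<⇒<ᵇ-pair : ∀ {f a} → f < a → ((f <ᵇ a) ≡ true) × ((a <ᵇ f) ≡ false)
<⇒<ᵇ-pair f<a = <⇒<ᵇ≡true f<a , ≥⇒<ᵇ≡false (<⇒≤ f<a)

AllStacked-above : ∀ {X Y} → All (λ a → All (_< a) Y) X → AllStacked true X Y
AllStacked-above = All.map (All.map <⇒<ᵇ-pair)

AllStacked-below : ∀ {X Y} → All (λ a → All (a <_) Y) X → AllStacked false X Y
AllStacked-below = All.map (All.map (λ a<f → let (a<ᵇf , f<ᵇa) = <⇒<ᵇ-pair a<f in f<ᵇa , a<ᵇf))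

all-sameOrder-stacked : ∀ up x a R s → length R ≡ length s →
  All (λ f → ((f <ᵇ a) ≡ up) × ((a <ᵇ f) ≡ not up)) s →
  all (sameOrder x a) (zip R s) ≡ all (stacked up x) R
all-sameOrder-stacked up x a [] [] _ [] = refl
all-sameOrder-stacked up x a (r ∷ R) (f ∷ s) e ((f<a , a<f) ∷ h)
  rewrite all-sameOrder-stacked up x a R s (suc-injective e) h | f<a | a<f = refl

stackedMatch : Bool → List ℕ → List ℕ → List ℕ × List ℕ → ℕ
stackedMatch up s₁ s₂ (L , R) = ⟦ allStacked up L R ⟧ * ⟦ orderIso L s₁ ⟧ * ⟦ orderIso R s₂ ⟧

-- Because a is stacked against s₂, comparing x with R against a with s₂ is the same as x being stacked against R.
stackedMatch-∷ : ∀ up x a {s₁ s₂} → All (λ f → ((f <ᵇ a) ≡ up) × ((a <ᵇ f) ≡ not up)) s₂ → ∀ L R →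
  stackedMatch up s₁ s₂ (L , R) * ⟦ (length (L ++ R) ≡ᵇ length (s₁ ++ s₂)) ∧ all (sameOrder x a) (zip (L ++ R) (s₁ ++ s₂)) ⟧ ≡
  stackedMatch up (a ∷ s₁) s₂ (x ∷ L , R)
stackedMatch-∷ up x a {s₁} {s₂} a-stk L R with orderIso L s₁ in e₁ | orderIso R s₂ in e₂
... | false | _ rewrite *-zeroʳ ⟦ allStacked up L R ⟧ | *-zeroʳ ⟦ allStacked up (x ∷ L) R ⟧ = refl
... | true | false rewrite e₁ | *-zeroʳ (⟦ allStacked up L R ⟧ * 1)
      | *-zeroʳ (⟦ allStacked up (x ∷ L) R ⟧ * ⟦ (length L ≡ᵇ length s₁) ∧ all (sameOrder x a) (zip L s₁) ⟧) = refl
... | true | true rewrite e₁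
      | zip-++ L s₁ {R} {s₂} (orderIso⇒length≡ L s₁ e₁)
      | all-++ (sameOrder x a) (zip L s₁) (zip R s₂)
      | all-sameOrder-stacked up x a R s₂ (orderIso⇒length≡ R s₂ e₂) a-stk
      | length-++ L {R} | length-++ s₁ {s₂} | orderIso⇒length≡ L s₁ e₁ | orderIso⇒length≡ R s₂ e₂
      | ≡ᵇ-refl (length s₁ + length s₂) | ≡ᵇ-refl (length s₁)
      = reassociate (allStacked up L R) (all (sameOrder x a) (zip L s₁)) (all (stacked up x) R)
  where
  reassociate : ∀ u v w → ⟦ u ⟧ * 1 * 1 * ⟦ v ∧ w ⟧ ≡ ⟦ w ∧ u ⟧ * ⟦ v ⟧ * 1
  reassociate true true true = refl
  reassociate true true false = refl
  reassociate true false true = refl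
  reassociate true false false = refl
  reassociate false v true = refl
  reassociate false v false = refl

orderIso-++ : ∀ up s₁ s₂ → AllStacked up s₁ s₂ → ∀ σ →
  ⟦ orderIso σ (s₁ ++ s₂) ⟧ ≡ ∑ (splits σ) (stackedMatch up s₁ s₂)
orderIso-++ up [] [] _ [] = refl
orderIso-++ up [] (_ ∷ _) _ [] = refl
orderIso-++ up (_ ∷ _) s₂ _ [] = refl
orderIso-++ up [] s₂ _ (x ∷ σ) = sym (begin
  1 * ⟦ orderIso (x ∷ σ) s₂ ⟧ + ∑ (map (λ (L , R) → x ∷ L , R) (splits σ)) (stackedMatch up [] s₂)
    ≡⟨ cong₂ _+_ (*-identityˡ _) (trans (∑-map _ (splits σ) (stackedMatch up [] s₂)) (∑-zero (splits σ) vanish)) ⟩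
  ⟦ orderIso (x ∷ σ) s₂ ⟧ + 0
    ≡⟨ +-identityʳ _ ⟩
  ⟦ orderIso (x ∷ σ) s₂ ⟧
    ∎)
  where
  open ≡-Reasoning
  vanish : ∀ LR → stackedMatch up [] s₂ (x ∷ proj₁ LR , proj₂ LR) ≡ 0
  vanish (L , R) rewrite *-zeroʳ ⟦ allStacked up (x ∷ L) R ⟧ = refl
orderIso-++ up (a ∷ s₁) s₂ (a-stk ∷ s₁-stk) (x ∷ σ) = begin
  ⟦ orderIso σ (s₁ ++ s₂) ∧ H ⟧
    ≡⟨ ⟦∧⟧ (orderIso σ (s₁ ++ s₂)) H ⟩
  ⟦ orderIso σ (s₁ ++ s₂) ⟧ * ⟦ H ⟧
    ≡⟨ cong (_* ⟦ H ⟧) (orderIso-++ up s₁ s₂ s₁-stk σ) ⟩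
  ∑ (splits σ) (stackedMatch up s₁ s₂) * ⟦ H ⟧
    ≡⟨ sym (∑-*ʳ (splits σ) ⟦ H ⟧ (stackedMatch up s₁ s₂)) ⟩
  ∑ (splits σ) (λ LR → stackedMatch up s₁ s₂ LR * ⟦ H ⟧)
    ≡⟨ ∑-cong-local (splits σ) (λ {(L , R)} LR∈ → extend-by-x {L} {R} (∈-splits⇒++ σ LR∈)) ⟩
  ∑ (splits σ) (λ (L , R) → stackedMatch up (a ∷ s₁) s₂ (x ∷ L , R))
    ≡⟨ sym (∑-map _ (splits σ) (stackedMatch up (a ∷ s₁) s₂)) ⟩
  ∑ (splits (x ∷ σ)) (stackedMatch up (a ∷ s₁) s₂)
    ∎
  where
  open ≡-Reasoning
  H : Bool
  H = (length σ ≡ᵇ length (s₁ ++ s₂)) ∧ all (sameOrder x a) (zip σ (s₁ ++ s₂))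
  extend-by-x : ∀ {L R} → L ++ R ≡ σ → stackedMatch up s₁ s₂ (L , R) * ⟦ H ⟧ ≡ stackedMatch up (a ∷ s₁) s₂ (x ∷ L , R)
  extend-by-x {L} {R} refl = stackedMatch-∷ up x a a-stk L R

∑-subseqs-++ : ∀ (g : List ℕ → ℕ) X Y →
  ∑ (subseqs (X ++ Y)) g ≡ ∑[ s₁ ∈ subseqs X ] ∑[ s₂ ∈ subseqs Y ] g (s₁ ++ s₂)
∑-subseqs-++ g [] Y = sym (+-identityʳ _)
∑-subseqs-++ g (a ∷ X) Y = begin
  ∑ (map (a ∷_) (subseqs (X ++ Y)) ++ subseqs (X ++ Y)) g
    ≡⟨ ∑-++ (map (a ∷_) (subseqs (X ++ Y))) (subseqs (X ++ Y)) g ⟩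
  ∑ (map (a ∷_) (subseqs (X ++ Y))) g + ∑ (subseqs (X ++ Y)) g
    ≡⟨ cong₂ _+_ (trans (∑-map (a ∷_) (subseqs (X ++ Y)) g) (∑-subseqs-++ (g ∘ (a ∷_)) X Y)) (∑-subseqs-++ g X Y) ⟩
  ∑[ s₁ ∈ subseqs X ] inner (a ∷ s₁) + ∑[ s₁ ∈ subseqs X ] inner s₁
    ≡⟨ cong (_+ ∑ (subseqs X) inner) (sym (∑-map (a ∷_) (subseqs X) inner)) ⟩
  ∑ (map (a ∷_) (subseqs X)) inner + ∑ (subseqs X) inner
    ≡⟨ sym (∑-++ (map (a ∷_) (subseqs X)) (subseqs X) inner) ⟩
  ∑ (subseqs (a ∷ X)) inner
    ∎
  where
  open ≡-Reasoning
  inner : List ℕ → ℕ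
  inner s₁ = ∑[ s₂ ∈ subseqs Y ] g (s₁ ++ s₂)

All-subseqs : ∀ {P : ℕ → Set} {X} → All P X → All (All P) (subseqs X)
All-subseqs [] = [] ∷ []
All-subseqs (pa ∷ pX) = All.++⁺ (All.map⁺ (All.map (pa ∷_) (All-subseqs pX))) (All-subseqs pX)

subseqs-map : ∀ (f : ℕ → ℕ) p → subseqs (map f p) ≡ map (map f) (subseqs p)
subseqs-map f [] = refl
subseqs-map f (x ∷ p) rewrite subseqs-map f p =
  trans (cong (_++ map (map f) (subseqs p)) (trans (sym (map-∘ (subseqs p))) (map-∘ (subseqs p))))
        (sym (map-++ (map f) (map (x ∷_) (subseqs p)) (subseqs p)))

copies-∑ : ∀ q p → copies q p ≡ ∑[ s ∈ subseqs p ] ⟦ orderIso q s ⟧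
copies-∑ q p = length-filter (orderIso q) (subseqs p)

copies-shiftʳ : ∀ c σ p → copies σ (map (_+ c) p) ≡ copies σ p
copies-shiftʳ c σ p rewrite copies-∑ σ (map (_+ c) p) | copies-∑ σ p | subseqs-map (_+ c) p =
  trans (∑-map (map (_+ c)) (subseqs p) _) (∑-cong (subseqs p) (λ s → cong ⟦_⟧ (orderIso-shiftʳ c σ s)))

copies-shiftˡ : ∀ c σ p → copies (map (_+ c) σ) p ≡ copies σ p
copies-shiftˡ c σ p rewrite copies-∑ (map (_+ c) σ) p | copies-∑ σ p =
  ∑-cong (subseqs p) (λ s → cong ⟦_⟧ (orderIso-shiftˡ c σ s))

copies-++ : ∀ up X Y → AllStacked up X Y → ∀ σ →
  copies σ (X ++ Y) ≡ ∑ (splits σ) (λ (L , R) → ⟦ allStacked up L R ⟧ * copies L X * copies R Y)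
copies-++ up X Y stk σ = begin
  copies σ (X ++ Y)
    ≡⟨ copies-∑ σ (X ++ Y) ⟩
  ∑[ s ∈ subseqs (X ++ Y) ] ⟦ orderIso σ s ⟧
    ≡⟨ ∑-subseqs-++ (λ s → ⟦ orderIso σ s ⟧) X Y ⟩
  ∑[ s₁ ∈ subseqs X ] ∑[ s₂ ∈ subseqs Y ] ⟦ orderIso σ (s₁ ++ s₂) ⟧
    ≡⟨ ∑-cong-local (subseqs X) (λ s₁∈ → ∑-cong-local (subseqs Y) (λ s₂∈ →
         orderIso-++ up _ _ (All.map (λ h → All.lookup (All-subseqs h) s₂∈) (All.lookup (All-subseqs stk) s₁∈)) σ)) ⟩
  ∑[ s₁ ∈ subseqs X ] ∑[ s₂ ∈ subseqs Y ] ∑ (splits σ) (stackedMatch up s₁ s₂)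
    ≡⟨ ∑-cong (subseqs X) (λ s₁ → ∑-swap (subseqs Y) (splits σ) (stackedMatch up s₁)) ⟩
  ∑[ s₁ ∈ subseqs X ] ∑[ LR ∈ splits σ ] ∑[ s₂ ∈ subseqs Y ] stackedMatch up s₁ s₂ LR
    ≡⟨ ∑-swap (subseqs X) (splits σ) _ ⟩
  ∑[ LR ∈ splits σ ] ∑[ s₁ ∈ subseqs X ] ∑[ s₂ ∈ subseqs Y ] stackedMatch up s₁ s₂ LR
    ≡⟨ ∑-cong (splits σ) factorise ⟩
  ∑ (splits σ) (λ (L , R) → ⟦ allStacked up L R ⟧ * copies L X * copies R Y)
    ∎
  where
  open ≡-Reasoning
  factorise : ∀ LR → ∑[ s₁ ∈ subseqs X ] ∑[ s₂ ∈ subseqs Y ] stackedMatch up s₁ s₂ LR ≡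
                     ⟦ allStacked up (proj₁ LR) (proj₂ LR) ⟧ * copies (proj₁ LR) X * copies (proj₂ LR) Y
  factorise (L , R) = trans (∑∑-* ⟦ allStacked up L R ⟧ (subseqs X) (subseqs Y) _ _)
                            (sym (cong₂ (λ c d → ⟦ allStacked up L R ⟧ * c * d) (copies-∑ L X) (copies-∑ R Y)))

atMostOne : List ℕ → ℕ
atMostOne R = copies R (0 ∷ [])

copies-singleton : ∀ R N → copies R (N ∷ []) ≡ atMostOne R
copies-singleton [] N = refl
copies-singleton (_ ∷ []) N = refl
copies-singleton (_ ∷ _ ∷ _) N = refl

[]∈subseqs : ∀ w → [] ∈ subseqs w
[]∈subseqs [] = here refl
[]∈subseqs (a ∷ w) = ∈-++⁺ʳ (map (a ∷_) (subseqs w)) ([]∈subseqs w)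

∷∈subseqs-++ : ∀ {a} x {w s} → a ∈ x → s ∈ subseqs w → a ∷ s ∈ subseqs (x ++ w)
∷∈subseqs-++ (c ∷ x) (here refl) s∈ = ∈-++⁺ˡ (∈-map⁺ (c ∷_) (subseqs-++⁺ʳ x s∈))
  where
  subseqs-++⁺ʳ : ∀ u {w s} → s ∈ subseqs w → s ∈ subseqs (u ++ w)
  subseqs-++⁺ʳ [] s∈ = s∈
  subseqs-++⁺ʳ (c ∷ u) s∈ = ∈-++⁺ʳ (map (c ∷_) (subseqs (u ++ _))) (subseqs-++⁺ʳ u s∈)
∷∈subseqs-++ (c ∷ x) (there a∈) s∈ = ∈-++⁺ʳ (map (c ∷_) (subseqs (x ++ _))) (∷∈subseqs-++ x a∈ s∈)

copies-++-≥ˡ : ∀ σ x w → copies σ x ≤ copies σ (x ++ w)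
copies-++-≥ˡ σ x w rewrite copies-∑ σ x | copies-∑ σ (x ++ w) | ∑-subseqs-++ (λ s → ⟦ orderIso σ s ⟧) x w =
  ∑-mono-≤ (subseqs x) λ s₁ →
    subst (λ s → ⟦ orderIso σ s ⟧ ≤ ∑[ s₂ ∈ subseqs w ] ⟦ orderIso σ (s₁ ++ s₂) ⟧) (++-identityʳ s₁)
    (∈⇒≤∑ (λ s₂ → ⟦ orderIso σ (s₁ ++ s₂) ⟧) ([]∈subseqs w))

copies-++-≥ʳ : ∀ σ u w → copies σ w ≤ copies σ (u ++ w)
copies-++-≥ʳ σ u w rewrite copies-∑ σ w | copies-∑ σ (u ++ w) | ∑-subseqs-++ (λ s → ⟦ orderIso σ s ⟧) u w =
  ∈⇒≤∑ (λ s₁ → ∑[ s₂ ∈ subseqs w ] ⟦ orderIso σ (s₁ ++ s₂) ⟧) ([]∈subseqs u)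

orderIso-132 : ∀ {a N b} → a < b → b < N → orderIso p132 (a ∷ N ∷ b ∷ []) ≡ true
orderIso-132 {a} {N} {b} a<b b<N
  rewrite <⇒<ᵇ≡true (<-trans a<b b<N) | <⇒<ᵇ≡true a<b | <⇒<ᵇ≡true b<N
        | ≥⇒<ᵇ≡false {N} {a} (<⇒≤ (<-trans a<b b<N)) | ≥⇒<ᵇ≡false {b} {a} (<⇒≤ a<b)
        | ≥⇒<ᵇ≡false {N} {b} (<⇒≤ b<N) = refl

-- Permutations and 132-avoiders

Bounded : ℕ → List ℕ → Set
Bounded k α = All (λ a → 1 ≤ a × a ≤ k) α

shifted-below : ∀ {k} m {α} → Bounded k α → All (_< suc (k + m)) (map (_+ m) α)
shifted-below m bnd = All.map⁺ (All.map (λ (_ , a≤k) → s≤s (+-monoˡ-≤ m a≤k)) bnd)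

record IsPermOf (n : ℕ) (p : List ℕ) : Set where
  constructor isPermOf
  field
    length≡ : length p ≡ n
    bounded : Bounded n p
    occ≡1   : ∀ i → 1 ≤ i → i ≤ n → occ i p ≡ 1

Av : ℕ → List (List ℕ)
Av k = filter (λ p → T? (avoids p132 p)) (perms k)

counts : List ℕ → Seq
counts σ k = S k p132 σ

∈-oneTo⁺ : ∀ {i n} → 1 ≤ i → i ≤ n → i ∈ oneTo n
∈-oneTo⁺ {suc i} _ i≤n = ∈-map⁺ suc (∈-upTo⁺ i≤n)

∈-oneTo⁻ : ∀ {i n} → i ∈ oneTo n → 1 ≤ i × i ≤ n
∈-oneTo⁻ i∈ with ∈-map⁻ suc i∈
... | _ , j∈ , refl = s≤s z≤n , ∈-upTo⁻ j∈

isPerm⁻ : ∀ p → IsPerm p → ∀ i → 1 ≤ i → i ≤ length p → occ i p ≡ 1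
isPerm⁻ p e i 1≤i i≤n = ≡ᵇ-true⇒≡ (All.lookup (all-true⁻ (λ i → occ i p ≡ᵇ 1) (oneTo (length p)) e) (∈-oneTo⁺ 1≤i i≤n))

isPerm⁺ : ∀ p → (∀ i → 1 ≤ i → i ≤ length p → occ i p ≡ 1) → IsPerm p
isPerm⁺ p occ≡1 = all-true⁺ (λ i → occ i p ≡ᵇ 1) (All.tabulate λ i∈ →
  let (1≤i , i≤n) = ∈-oneTo⁻ i∈ in cong (_≡ᵇ 1) (occ≡1 _ 1≤i i≤n))

∈-lists⁻ : ∀ n m {p} → p ∈ lists n m → Bounded m p × length p ≡ n
∈-lists⁻ zero m (here refl) = [] , refl
∈-lists⁻ (suc n) m p∈ with find (∈-concatMap⁻ (λ x → map (x ∷_) (lists n m)) {xs = oneTo m} p∈)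
... | x , x∈ , p∈′ with ∈-map⁻ (x ∷_) p∈′
... | p′ , p′∈ , refl = let (bnd , len) = ∈-lists⁻ n m p′∈ in (∈-oneTo⁻ x∈ ∷ bnd) , cong suc len

∈-lists⁺ : ∀ m {p} → Bounded m p → p ∈ lists (length p) m
∈-lists⁺ m [] = here refl
∈-lists⁺ m {x ∷ p} ((1≤x , x≤m) ∷ bnd) =
  ∈-concatMap⁺ (λ y → map (y ∷_) (lists (length p) m)) {xs = oneTo m}
    (Any.map (λ { refl → ∈-map⁺ (x ∷_) (∈-lists⁺ m bnd) }) (∈-oneTo⁺ 1≤x x≤m))

∈-Av⁻ : ∀ n {p} → p ∈ Av n → IsPermOf n p × copies p132 p ≡ 0
∈-Av⁻ n {p} p∈ with ∈-filter⁻ (λ p → T? (avoids p132 p)) p∈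
... | p∈perms , avoids-p with ∈-filter⁻ (λ p → T? (isPerm p)) p∈perms
... | p∈lists , isPerm-p with ∈-lists⁻ n n p∈lists
... | bnd , len = isPermOf len bnd (λ i 1≤i i≤n → isPerm⁻ p (Equivalence.to T-≡ isPerm-p) i 1≤i (subst (i ≤_) (sym len) i≤n))
                , ≡ᵇ-true⇒≡ (Equivalence.to T-≡ avoids-p)

∈-Av⁺ : ∀ n {p} → IsPermOf n p → copies p132 p ≡ 0 → p ∈ Av n
∈-Av⁺ n {p} (isPermOf len bnd occ≡1) no132 =
  ∈-filter⁺ (λ p → T? (avoids p132 p))
    (∈-filter⁺ (λ p → T? (isPerm p)) (subst (λ l → p ∈ lists l n) len (∈-lists⁺ n bnd))
      (Equivalence.from T-≡ (isPerm⁺ p (λ i 1≤i i≤l → occ≡1 i 1≤i (subst (i ≤_) len i≤l)))))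
    (Equivalence.from T-≡ (cong (_≡ᵇ 0) no132))

Unique-concatMap : ∀ (f : B → List A) {xs} → Unique xs → (∀ {x} → x ∈ xs → Unique (f x)) →
  (∀ {x y z} → x ∈ xs → y ∈ xs → z ∈ f x → z ∈ f y → x ≡ y) → Unique (concatMap f xs)
Unique-concatMap f {[]} _ _ _ = []
Unique-concatMap f {x ∷ xs} (x∉xs ∷ uxs) uf disj =
  Unique.++⁺ (uf (here refl)) (Unique-concatMap f uxs (uf ∘ there) (λ x∈ y∈ → disj (there x∈) (there y∈)))
    λ (z∈fx , z∈rest) → let (y , y∈ , z∈fy) = find (∈-concatMap⁻ f {xs = xs} z∈rest)
                        in All.lookup x∉xs y∈ (disj (here refl) (there y∈) z∈fx z∈fy)

Unique-lists : ∀ n m → Unique (lists n m)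
Unique-lists zero m = [] ∷ []
Unique-lists (suc n) m = Unique-concatMap (λ x → map (x ∷_) (lists n m))
  (Unique.map⁺ suc-injective (Unique.upTo⁺ m)) (λ _ → Unique.map⁺ ∷-injectiveʳ (Unique-lists n m)) disjoint
  where
  disjoint : ∀ {x y z} → x ∈ oneTo m → y ∈ oneTo m → z ∈ map (x ∷_) (lists n m) → z ∈ map (y ∷_) (lists n m) → x ≡ y
  disjoint _ _ z∈x z∈y with ∈-map⁻ _ z∈x | ∈-map⁻ _ z∈y
  ... | _ , _ , refl | _ , _ , e = ∷-injectiveˡ e

Unique-Av : ∀ n → Unique (Av n)
Unique-Av n = Unique.filter⁺ (λ p → T? (avoids p132 p)) (Unique.filter⁺ (λ p → T? (isPerm p)) (Unique-lists n n))

∑-occ-swap : ∀ p I → ∑[ i ∈ I ] occ i p ≡ ∑[ a ∈ p ] occ a I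
∑-occ-swap p I = begin
  ∑[ i ∈ I ] occ i p                   ≡⟨ ∑-cong I (λ i → occ-∑ i p) ⟩
  ∑[ i ∈ I ] ∑[ a ∈ p ] ⟦ i ≡ᵇ a ⟧      ≡⟨ ∑-swap I p _ ⟩
  ∑[ a ∈ p ] ∑[ i ∈ I ] ⟦ i ≡ᵇ a ⟧      ≡⟨ ∑-cong p (λ a → ∑-cong I (λ i → cong ⟦_⟧ (≡ᵇ-sym i a))) ⟩
  ∑[ a ∈ p ] ∑[ i ∈ I ] ⟦ a ≡ᵇ i ⟧      ≡⟨ ∑-cong p (λ a → sym (occ-∑ a I)) ⟩
  ∑[ a ∈ p ] occ a I                   ∎
  where open ≡-Reasoning

occ-Unique-≤1 : ∀ a {I} → Unique I → occ a I ≤ 1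
occ-Unique-≤1 a {[]} _ = z≤n
occ-Unique-≤1 a {x ∷ I} (x∉I ∷ uI) with a ≡ᵇ x in a≡ᵇx
... | true rewrite ≡ᵇ-true⇒≡ {a} {x} a≡ᵇx | occ-absent x∉I = s≤s z≤n
... | false = occ-Unique-≤1 a uI

∑≡length⇒All≡1 : ∀ (f : ℕ → ℕ) p → (∀ a → f a ≤ 1) → ∑ p f ≡ length p → All (λ a → f a ≡ 1) p
∑≡length⇒All≡1 f [] _ _ = []
∑≡length⇒All≡1 f (a ∷ p) f≤1 e with m≤n⇒m<n∨m≡n (f≤1 a)
... | inj₂ fa≡1 = fa≡1 ∷ ∑≡length⇒All≡1 f p f≤1 (suc-injective (trans (cong (_+ ∑ p f) (sym fa≡1)) e))
... | inj₁ (s≤s fa≤0) = ⊥-elim (<-irrefl e (<-≤-trans (+-monoˡ-< (∑ p f) (s≤s fa≤0)) (+-monoʳ-≤ 1 (∑≤length p))))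
  where
  ∑≤length : ∀ p → ∑ p f ≤ length p
  ∑≤length [] = z≤n
  ∑≤length (b ∷ p) = +-mono-≤ (f≤1 b) (∑≤length p)

-- Each of 1, …, n occurs once among the n entries of p, so no entry is left for anything else.
IsPerm⇒Bounded : ∀ p → IsPerm p → Bounded (length p) p
IsPerm⇒Bounded p isPerm-p =
  All.map (λ a∈I → ∈-oneTo⁻ (occ≡suc⇒∈ I a∈I)) (∑≡length⇒All≡1 (λ a → occ a I) p (λ a → occ-Unique-≤1 a I-Unique) total)
  where
  I = oneTo (length p)
  I-Unique : Unique I
  I-Unique = Unique.map⁺ suc-injective (Unique.upTo⁺ (length p))
  total : ∑[ a ∈ p ] occ a I ≡ length p
  total = begin
    ∑[ a ∈ p ] occ a I  ≡⟨ sym (∑-occ-swap p I) ⟩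
    ∑[ i ∈ I ] occ i p  ≡⟨ ∑-cong-local I (λ i∈ → let (1≤i , i≤n) = ∈-oneTo⁻ i∈ in isPerm⁻ p isPerm-p _ 1≤i i≤n) ⟩
    ∑[ i ∈ I ] 1        ≡⟨ ∑-1≡length I ⟩
    length I            ≡⟨ trans (length-map suc (upTo (length p))) (length-applyUpTo id (length p)) ⟩
    length p            ∎
    where open ≡-Reasoning

last≡just⇒∷ʳ : ∀ (q : List ℕ) {v} → last q ≡ just v → Σ (List ℕ) λ q′ → q ≡ q′ ++ v ∷ []
last≡just⇒∷ʳ (x ∷ []) refl = [] , refl
last≡just⇒∷ʳ (x ∷ y ∷ q) e with last≡just⇒∷ʳ (y ∷ q) e
... | q′ , q≡ = x ∷ q′ , cong (x ∷_) q≡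

EndsInMax⇒∷ʳ : ∀ q → IsPerm q → EndsInMax q → Σ (List ℕ) λ q′ → q ≡ q′ ++ length q ∷ [] × All (_< length q) q′
EndsInMax⇒∷ʳ q isPerm-q ends with last≡just⇒∷ʳ q ends
... | q′ , q≡ = q′ , q≡ , All.tabulate λ {a} a∈q′ → ≤∧≢⇒< (proj₂ (All.lookup bnd (∈-++⁺ˡ a∈q′))) (a≢n a∈q′)
  where
  n = length q
  bnd : Bounded n (q′ ++ n ∷ [])
  bnd = subst (Bounded n) q≡ (IsPerm⇒Bounded q isPerm-q)
  n≥1 : 1 ≤ n
  n≥1 = subst (1 ≤_) (sym (trans (cong length q≡) (trans (length-++ q′) (+-comm (length q′) 1)))) (s≤s z≤n)
  a≢n : ∀ {a} → a ∈ q′ → a ≢ n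
  a≢n a∈q′ refl = <-irrefl (sym (subst (λ l → occ n l ≡ 1) q≡ (isPerm⁻ q isPerm-q n n≥1 ≤-refl)))
                            (∈-++⇒occ≥2 q′ a∈q′ (here refl))

IsPermOf-remove-max : ∀ w u v → IsPermOf (suc w) (u ++ suc w ∷ v) → IsPermOf w (u ++ v)
IsPermOf-remove-max w u v (isPermOf len bnd occ≡1) = isPermOf len′ bnd′ occ≡1′
  where
  N = suc w
  len′ : length (u ++ v) ≡ w
  len′ = suc-injective (trans (sym (length-++-∷ u N v)) len)
  N∉ : occ N (u ++ v) ≡ 0
  N∉ = suc-injective (trans (cong (_+ occ N (u ++ v)) (sym (occ-self N []))) (trans (sym (occ-++-∷ N u N v)) (occ≡1 N (s≤s z≤n) ≤-refl)))
  bnd′ : Bounded w (u ++ v)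
  bnd′ = All.tabulate λ {e} e∈ →
    let (1≤e , e≤N) = All.lookup bnd (∈-++-insert u e∈)
    in 1≤e , s≤s⁻¹ (≤∧≢⇒< e≤N λ { refl → <-irrefl (sym N∉) (∈⇒occ≥1 e∈) })
  occ≡1′ : ∀ i → 1 ≤ i → i ≤ w → occ i (u ++ v) ≡ 1
  occ≡1′ i 1≤i i≤w = begin
    occ i (u ++ v)                   ≡⟨ cong (_+ occ i (u ++ v)) (sym (occ-skip [] (<⇒≢ (s≤s i≤w)))) ⟩
    occ i (N ∷ []) + occ i (u ++ v)  ≡⟨ sym (occ-++-∷ i u N v) ⟩
    occ i (u ++ N ∷ v)               ≡⟨ occ≡1 i 1≤i (m≤n⇒m≤1+n i≤w) ⟩
    1                                ∎
    where open ≡-Reasoning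

-- The maximum of x ++ y lies in x; removing it keeps x above y, so induct on the size.
IsPermOf-stacked-suffix : ∀ w {x y} → IsPermOf w (x ++ y) → All (λ a → All (_< a) y) x →
  IsPermOf (length y) y × All (length y <_) x
IsPermOf-stacked-suffix w {[]} {y} (isPermOf len bnd occ≡1) [] =
  isPermOf refl (subst (λ w → Bounded w y) (sym len) bnd) (λ i 1≤i i≤ → occ≡1 i 1≤i (subst (i ≤_) len i≤)) , []
IsPermOf-stacked-suffix zero {_ ∷ _} (isPermOf () _ _) _
IsPermOf-stacked-suffix (suc w) {x@(_ ∷ _)} {y} P x>y
  with ∈-++⁻ x (occ≡suc⇒∈ (x ++ y) (IsPermOf.occ≡1 P (suc w) (s≤s z≤n) ≤-refl))
... | inj₂ N∈y = ⊥-elim (<-irrefl refl (<-≤-trans (All.lookup (All.head x>y) N∈y) (proj₂ (All.head (IsPermOf.bounded P)))))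
... | inj₁ N∈x with ∈-∃++ N∈x
... | x₁ , x₂ , x≡ = proj₁ IH , subst (All (length y <_)) (sym x≡) (All-++-∷⁺ x₁ (s≤s |y|≤w) (proj₂ IH))
  where
  P′ : IsPermOf w ((x₁ ++ x₂) ++ y)
  P′ = subst (IsPermOf w) (sym (++-assoc x₁ x₂ y))
         (IsPermOf-remove-max w x₁ (x₂ ++ y) (subst (IsPermOf (suc w)) (trans (cong (_++ y) x≡) (++-assoc x₁ (suc w ∷ x₂) y)) P))
  IH : IsPermOf (length y) y × All (length y <_) (x₁ ++ x₂)
  IH = IsPermOf-stacked-suffix w P′ (proj₂ (All-++-∷⁻ x₁ (subst (All (λ a → All (_< a) y)) x≡ x>y)))
  |y|≤w : length y ≤ w
  |y|≤w = subst (length y ≤_) (trans (sym (length-++ (x₁ ++ x₂))) (IsPermOf.length≡ P′)) (m≤n+m (length y) (length (x₁ ++ x₂)))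

-- An entry a left of the maximum N and an entry b right of it with a < b would form the copy a N b of 132.
avoider-stacked : ∀ n x y → IsPermOf (suc n) (x ++ suc n ∷ y) → copies p132 (x ++ suc n ∷ y) ≡ 0 →
  All (λ a → All (_< a) y) x
avoider-stacked n x y (isPermOf _ bnd occ≡1) avoids = All.tabulate λ {a} a∈x → All.tabulate λ {b} b∈y → b<a a∈x b∈y
  where
  N = suc n
  z = x ++ N ∷ y
  b<a : ∀ {a b} → a ∈ x → b ∈ y → b < a
  b<a {a} {b} a∈x b∈y with b <? a
  ... | yes b<a = b<a
  ... | no b≮a = ⊥-elim (<-irrefl (sym avoids) (<-≤-trans (s≤s z≤n) (subst (1 ≤_) (sym (copies-∑ p132 z)) one-copy)))
    where
    a≢b : a ≢ b
    a≢b refl = <-irrefl (sym (occ≡1 a (proj₁ a-bnd) (proj₂ a-bnd))) (∈-++⇒occ≥2 x a∈x (there b∈y))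
      where a-bnd = All.lookup bnd (∈-++⁺ˡ a∈x)
    b≢N : b ≢ N
    b≢N refl = <-irrefl (sym (occ≡1 N (s≤s z≤n) ≤-refl))
      (subst (λ l → 2 ≤ occ N l) (++-assoc x (N ∷ []) y) (∈-++⇒occ≥2 (x ++ N ∷ []) (∈-++⁺ʳ x (here refl)) b∈y))
    copy∈ : a ∷ N ∷ b ∷ [] ∈ subseqs z
    copy∈ = ∷∈subseqs-++ x a∈x (∈-++⁺ˡ (∈-map⁺ (N ∷_)
              (subst (λ t → b ∷ [] ∈ subseqs t) (++-identityʳ y) (∷∈subseqs-++ y b∈y ([]∈subseqs [])))))
    one-copy : 1 ≤ ∑[ s ∈ subseqs z ] ⟦ orderIso p132 s ⟧
    one-copy = subst (λ t → ⟦ t ⟧ ≤ _)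
                 (orderIso-132 (≤∧≢⇒< (≮⇒≥ b≮a) a≢b) (≤∧≢⇒< (proj₂ (All.lookup bnd (∈-++⁺ʳ x (there b∈y)))) b≢N))
                 (∈⇒≤∑ (λ s → ⟦ orderIso p132 s ⟧) copy∈)

shift-unshift : ∀ m x → All (m <_) x → map (_+ m) (map (_∸ m) x) ≡ x
shift-unshift m [] [] = refl
shift-unshift m (a ∷ x) (m<a ∷ m<x) = cong₂ _∷_ (m∸n+n≡m (<⇒≤ m<a)) (shift-unshift m x m<x)

IsPermOf-unshift : ∀ n x y → IsPermOf n (x ++ y) → IsPermOf (length y) y → All (length y <_) x →
  IsPermOf (length x) (map (_∸ length y) x)
IsPermOf-unshift n x y P Py y<x = isPermOf (length-map (_∸ m) x) α-bnd occα
  where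
  m = length y
  k = length x
  α = map (_∸ m) x
  k+m≡n : k + m ≡ n
  k+m≡n = trans (sym (length-++ x)) (IsPermOf.length≡ P)
  α-bnd : Bounded k α
  α-bnd = All.map⁺ (All.map (λ (m<a , _ , a≤n) → m<n⇒0<n∸m m<a ,
                                 subst (_ ≤_) (m+n∸n≡m k m) (∸-monoˡ-≤ m (subst (_ ≤_) (sym k+m≡n) a≤n)))
                            (All.zip (y<x , proj₁ (All.++⁻ x (IsPermOf.bounded P)))))
  occα : ∀ i → 1 ≤ i → i ≤ k → occ i α ≡ 1
  occα i 1≤i i≤k = begin
    occ i α                            ≡⟨ sym (occ-shift m i α) ⟩
    occ (i + m) (map (_+ m) α)         ≡⟨ cong (occ (i + m)) (shift-unshift m x y<x) ⟩
    occ (i + m) x                      ≡⟨ sym (+-identityʳ _) ⟩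
    occ (i + m) x + 0                  ≡⟨ cong (occ (i + m) x +_) (sym (occ-absent y-below)) ⟩
    occ (i + m) x + occ (i + m) y      ≡⟨ sym (occ-++ (i + m) x y) ⟩
    occ (i + m) (x ++ y)               ≡⟨ IsPermOf.occ≡1 P (i + m) (≤-trans 1≤i (m≤m+n i m))
                                                           (subst (i + m ≤_) k+m≡n (+-monoˡ-≤ m i≤k)) ⟩
    1                                  ∎
    where
    open ≡-Reasoning
    y-below : All (i + m ≢_) y
    y-below = All.map (λ (_ , b≤m) → >⇒≢ (≤-<-trans b≤m (m<n+m m 1≤i))) (IsPermOf.bounded Py)

-- Decomposition at the maximum

copies-∷ʳ-max : ∀ α N → All (_< N) α → ∀ L →
  copies L (α ++ N ∷ []) ≡ ∑ (splits L) (λ (L₁ , L₂) → ⟦ allStacked false L₁ L₂ ⟧ * copies L₁ α * atMostOne L₂)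
copies-∷ʳ-max α N α<N L = trans (copies-++ false α (N ∷ []) (AllStacked-below (All.map (_∷ []) α<N)) L)
  (∑-cong (splits L) λ (L₁ , L₂) → cong (⟦ allStacked false L₁ L₂ ⟧ * copies L₁ α *_) (copies-singleton L₂ N))

joinAtMax : ℕ → List ℕ → ℕ → List ℕ → List ℕ
joinAtMax m α N β = map (_+ m) α ++ N ∷ β

copies-joinAtMax : ∀ k m α β → Bounded k α → All (_≤ m) β → ∀ σ →
  copies σ (joinAtMax m α (suc (k + m)) β) ≡
  ∑ (splits σ) (λ (L , R) → ⟦ allStacked true L R ⟧ * copies L (map (_+ m) α ++ suc (k + m) ∷ []) * copies R β)
copies-joinAtMax k m α β α-bnd β≤m σ =
  trans (cong (copies σ) (sym (++-assoc (map (_+ m) α) (N ∷ []) β)))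
        (copies-++ true (map (_+ m) α ++ N ∷ []) β (AllStacked-above (All.++⁺ α-above (N-above ∷ []))) σ)
  where
  N = suc (k + m)
  α-above : All (λ a → All (_< a) β) (map (_+ m) α)
  α-above = All.map⁺ (All.map (λ (1≤a , _) → All.map (λ b≤m → ≤-<-trans b≤m (m<n+m m 1≤a)) β≤m) α-bnd)
  N-above : All (_< N) β
  N-above = All.map (λ b≤m → s≤s (≤-trans b≤m (m≤n+m m k))) β≤m

-- counts⊕₁ L k counts copies of L in the α ⊕ 1 with α ∈ Av k (∑-Av-copies-⊕₁).
counts⊕₁ : List ℕ → Seq
counts⊕₁ L k = ∑ (splits L) (λ (L₁ , L₂) → ⟦ allStacked false L₁ L₂ ⟧ * counts L₁ k * atMostOne L₂)

∑-Av-copies-⊕₁ : ∀ k m L → ∑[ α ∈ Av k ] copies L (map (_+ m) α ++ suc (k + m) ∷ []) ≡ counts⊕₁ L k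
∑-Av-copies-⊕₁ k m L = begin
  ∑[ α ∈ Av k ] copies L (map (_+ m) α ++ suc (k + m) ∷ [])
    ≡⟨ ∑-cong-local (Av k) (λ α∈ → copies-∷ʳ-max _ _ (shifted-below m (IsPermOf.bounded (proj₁ (∈-Av⁻ k α∈)))) L) ⟩
  ∑[ α ∈ Av k ] ∑ (splits L) (λ (L₁ , L₂) → ⟦ allStacked false L₁ L₂ ⟧ * copies L₁ (map (_+ m) α) * atMostOne L₂)
    ≡⟨ ∑-swap (Av k) (splits L) _ ⟩
  ∑ (splits L) (λ (L₁ , L₂) → ∑[ α ∈ Av k ] (⟦ allStacked false L₁ L₂ ⟧ * copies L₁ (map (_+ m) α) * atMostOne L₂))
    ≡⟨ ∑-cong (splits L) (λ (L₁ , L₂) → factor ⟦ allStacked false L₁ L₂ ⟧ (atMostOne L₂) L₁) ⟩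
  counts⊕₁ L k
    ∎
  where
  open ≡-Reasoning
  factor : ∀ a b L₁ → ∑[ α ∈ Av k ] (a * copies L₁ (map (_+ m) α) * b) ≡ a * counts L₁ k * b
  factor a b L₁ = begin
    ∑[ α ∈ Av k ] (a * copies L₁ (map (_+ m) α) * b)  ≡⟨ ∑-cong (Av k) (λ α → cong (λ x → a * x * b) (copies-shiftʳ m L₁ α)) ⟩
    ∑[ α ∈ Av k ] (a * copies L₁ α * b)               ≡⟨ ∑-*ʳ (Av k) b _ ⟩
    ∑[ α ∈ Av k ] (a * copies L₁ α) * b               ≡⟨ cong (_* b) (∑-*ˡ (Av k) a _) ⟩
    a * counts L₁ k * b                               ∎

joinsOfSizes : ℕ → ℕ → List (List ℕ)
joinsOfSizes k m = concatMap (λ α → map (joinAtMax m α (suc (k + m))) (Av m)) (Av k)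

∑-joinsOfSizes : ∀ k m σ → ∑ (joinsOfSizes k m) (copies σ) ≡
  ∑ (splits σ) (λ (L , R) → ⟦ allStacked true L R ⟧ * counts⊕₁ L k * counts R m)
∑-joinsOfSizes k m σ = begin
  ∑ (joinsOfSizes k m) (copies σ)
    ≡⟨ ∑-concatMap (λ α → map (joinAtMax m α N) (Av m)) (Av k) (copies σ) ⟩
  ∑[ α ∈ Av k ] ∑ (map (joinAtMax m α N) (Av m)) (copies σ)
    ≡⟨ ∑-cong (Av k) (λ α → ∑-map (joinAtMax m α N) (Av m) (copies σ)) ⟩
  ∑[ α ∈ Av k ] ∑[ β ∈ Av m ] copies σ (joinAtMax m α N β)
    ≡⟨ ∑-cong-local (Av k) (λ α∈ → ∑-cong-local (Av m) (λ β∈ →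
         copies-joinAtMax k m _ _ (bounded α∈) (All.map proj₂ (bounded β∈)) σ)) ⟩
  ∑[ α ∈ Av k ] ∑[ β ∈ Av m ] ∑[ LR ∈ splits σ ] term α β LR
    ≡⟨ ∑-cong (Av k) (λ α → ∑-swap (Av m) (splits σ) (term α)) ⟩
  ∑[ α ∈ Av k ] ∑[ LR ∈ splits σ ] ∑[ β ∈ Av m ] term α β LR
    ≡⟨ ∑-swap (Av k) (splits σ) _ ⟩
  ∑[ LR ∈ splits σ ] ∑[ α ∈ Av k ] ∑[ β ∈ Av m ] term α β LR
    ≡⟨ ∑-cong (splits σ) (λ (L , R) →
         trans (∑∑-* ⟦ allStacked true L R ⟧ (Av k) (Av m) (λ α → copies L (map (_+ m) α ++ N ∷ [])) (copies R))
               (cong (λ x → ⟦ allStacked true L R ⟧ * x * counts R m) (∑-Av-copies-⊕₁ k m L))) ⟩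
  ∑ (splits σ) (λ (L , R) → ⟦ allStacked true L R ⟧ * counts⊕₁ L k * counts R m)
    ∎
  where
  open ≡-Reasoning
  N = suc (k + m)
  bounded : ∀ {j α} → α ∈ Av j → Bounded j α
  bounded {j} α∈ = IsPermOf.bounded (proj₁ (∈-Av⁻ j α∈))
  term : List ℕ → List ℕ → List ℕ × List ℕ → ℕ
  term α β (L , R) = ⟦ allStacked true L R ⟧ * copies L (map (_+ m) α ++ N ∷ []) * copies R β

joins : ℕ → List (List ℕ)
joins n = concatMap (λ k → joinsOfSizes k (n ∸ k)) (upTo (suc n))

∑-joins : ∀ n σ → ∑ (joins n) (copies σ) ≡ ∑ (splits σ) (stackedAbove (λ (L , R) → (counts⊕₁ L ⋆ counts R) n))
∑-joins n σ = begin
  ∑ (joins n) (copies σ)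
    ≡⟨ ∑-concatMap (λ k → joinsOfSizes k (n ∸ k)) (upTo (suc n)) (copies σ) ⟩
  ∑[ k ∈ upTo (suc n) ] ∑ (joinsOfSizes k (n ∸ k)) (copies σ)
    ≡⟨ ∑-cong (upTo (suc n)) (λ k → ∑-joinsOfSizes k (n ∸ k) σ) ⟩
  ∑[ k ∈ upTo (suc n) ] ∑[ LR ∈ splits σ ] term k LR
    ≡⟨ ∑-swap (upTo (suc n)) (splits σ) term ⟩
  ∑[ LR ∈ splits σ ] ∑[ k ∈ upTo (suc n) ] term k LR
    ≡⟨ ∑-cong (splits σ) (λ (L , R) → begin
         ∑[ k ∈ upTo (suc n) ] (⟦ allStacked true L R ⟧ * counts⊕₁ L k * counts R (n ∸ k))
           ≡⟨ ∑-cong (upTo (suc n)) (λ k → *-assoc ⟦ allStacked true L R ⟧ _ _) ⟩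
         ∑[ k ∈ upTo (suc n) ] (⟦ allStacked true L R ⟧ * (counts⊕₁ L k * counts R (n ∸ k)))
           ≡⟨ ∑-*ˡ (upTo (suc n)) ⟦ allStacked true L R ⟧ _ ⟩
         ⟦ allStacked true L R ⟧ * ∑[ k ∈ upTo (suc n) ] (counts⊕₁ L k * counts R (n ∸ k))
           ≡⟨ cong (⟦ allStacked true L R ⟧ *_) (sym (⋆-∑ (counts⊕₁ L) (counts R) n)) ⟩
         ⟦ allStacked true L R ⟧ * (counts⊕₁ L ⋆ counts R) n
           ∎) ⟩
  ∑ (splits σ) (stackedAbove (λ (L , R) → (counts⊕₁ L ⋆ counts R) n))
    ∎
  where
  open ≡-Reasoning
  term : ℕ → List ℕ × List ℕ → ℕ
  term k (L , R) = ⟦ allStacked true L R ⟧ * counts⊕₁ L k * counts R (n ∸ k)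

joinAtMax-IsPermOf : ∀ k m {α β} → IsPermOf k α → IsPermOf m β → IsPermOf (suc (k + m)) (joinAtMax m α (suc (k + m)) β)
joinAtMax-IsPermOf k m {α} {β} (isPermOf lenα bndα occα) (isPermOf lenβ bndβ occβ) = isPermOf len bnd occ≡1
  where
  N = suc (k + m)
  len : length (joinAtMax m α N β) ≡ N
  len rewrite length-++ (map (_+ m) α) {N ∷ β} | length-map (_+ m) α | lenα | lenβ = +-suc k m
  bnd : Bounded N (joinAtMax m α N β)
  bnd = All.++⁺ (All.map⁺ (All.map (λ {a} (1≤a , a≤k) → ≤-trans 1≤a (m≤m+n a m) , m≤n⇒m≤1+n (+-monoˡ-≤ m a≤k)) bndα))
                ((s≤s z≤n , ≤-refl) ∷ All.map (λ (1≤b , b≤m) → 1≤b , m≤n⇒m≤1+n (≤-trans b≤m (m≤n+m m k))) bndβ)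
  α-above : ∀ {i} → i ≤ m → All (i ≢_) (map (_+ m) α)
  α-above i≤m = All.map⁺ (All.map (λ (1≤a , _) → <⇒≢ (≤-<-trans i≤m (m<n+m m 1≤a))) bndα)
  β-below : ∀ {i} → m < i → All (i ≢_) β
  β-below m<i = All.map (λ (_ , b≤m) → >⇒≢ (≤-<-trans b≤m m<i)) bndβ
  occ≡1 : ∀ i → 1 ≤ i → i ≤ N → occ i (joinAtMax m α N β) ≡ 1
  occ≡1 i 1≤i i≤N rewrite occ-++ i (map (_+ m) α) (N ∷ β) with i ≤? m
  ... | yes i≤m rewrite occ-absent (α-above i≤m) | occ-skip β (<⇒≢ (≤-<-trans i≤m (s≤s (m≤n+m m k)))) = occβ i 1≤i i≤m
  ... | no i≰m with m≤n⇒m<n∨m≡n i≤N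
  ...   | inj₂ refl rewrite occ-absent (All.map⁺ (All.map (λ (_ , a≤k) → >⇒≢ (s≤s (+-monoˡ-≤ m a≤k))) bndα))
                          | occ-self N β | occ-absent (β-below (≰⇒> i≰m)) = refl
  ...   | inj₁ (s≤s i≤k+m) = begin
    occ i (map (_+ m) α) + occ i (N ∷ β)    ≡⟨ cong₂ _+_ (cong (λ x → occ x (map (_+ m) α)) (sym j+m≡i))
                                                         (trans (occ-skip β (<⇒≢ (s≤s i≤k+m))) (occ-absent (β-below m<i))) ⟩
    occ (j + m) (map (_+ m) α) + 0          ≡⟨ +-identityʳ _ ⟩
    occ (j + m) (map (_+ m) α)              ≡⟨ occ-shift m j α ⟩
    occ j α                                 ≡⟨ occα j (m<n⇒0<n∸m m<i) (+-cancelʳ-≤ m j k (subst (_≤ k + m) (sym j+m≡i) i≤k+m)) ⟩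
    1                                       ∎
    where
    open ≡-Reasoning
    m<i = ≰⇒> i≰m
    j = i ∸ m
    j+m≡i : j + m ≡ i
    j+m≡i = m∸n+n≡m (<⇒≤ m<i)

-- Of the four splits of 132 only (132 , []) contributes, both in α ⊕ 1 and in a join.
copies-132-⊕₁ : ∀ α N → All (_< N) α → copies p132 (α ++ N ∷ []) ≡ copies p132 α
copies-132-⊕₁ α N α<N = trans (copies-∷ʳ-max α N α<N p132) (lemma (copies [] α) (copies (1 ∷ []) α) (copies p132 α))
  where
  lemma : ∀ a b c → 1 * a * 0 + (1 * b * 0 + (0 + (1 * c * 1 + 0))) ≡ c
  lemma a b c rewrite *-zeroʳ (1 * a) | *-zeroʳ (1 * b) | *-identityʳ (1 * c) | +-identityʳ (1 * c) = *-identityˡ c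

joinAtMax-avoids : ∀ k m {α β} → Bounded k α → All (_≤ m) β → copies p132 α ≡ 0 → copies p132 β ≡ 0 →
  copies p132 (joinAtMax m α (suc (k + m)) β) ≡ 0
joinAtMax-avoids k m {α} {β} bndα β≤m α-avoids β-avoids =
  trans (copies-joinAtMax k m α β bndα β≤m p132)
        (lemma (copies [] (α′ ++ suc (k + m) ∷ [])) (copies p132 β) (copies p132 (α′ ++ suc (k + m) ∷ [])) (copies [] β)
               β-avoids (trans (copies-132-⊕₁ α′ _ (shifted-below m bndα)) (trans (copies-shiftʳ m p132 α) α-avoids)))
  where
  α′ = map (_+ m) α
  lemma : ∀ a b c d → b ≡ 0 → c ≡ 0 → 1 * a * b + (0 + (0 + (1 * c * d + 0))) ≡ 0
  lemma a _ _ d refl refl rewrite *-zeroʳ (1 * a) = refl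

∈-joinsOfSizes⁺ : ∀ {k m α β} → α ∈ Av k → β ∈ Av m → joinAtMax m α (suc (k + m)) β ∈ joinsOfSizes k m
∈-joinsOfSizes⁺ {k} {m} {α} α∈ β∈ =
  ∈-concatMap⁺ (λ α → map (joinAtMax m α (suc (k + m))) (Av m)) {xs = Av k}
    (Any.map (λ { refl → ∈-map⁺ (joinAtMax m α (suc (k + m))) β∈ }) α∈)

∈-joinsOfSizes⁻ : ∀ {k m z} → z ∈ joinsOfSizes k m →
  Σ (List ℕ) λ α → Σ (List ℕ) λ β → α ∈ Av k × β ∈ Av m × z ≡ joinAtMax m α (suc (k + m)) β
∈-joinsOfSizes⁻ {k} {m} z∈ with find (∈-concatMap⁻ (λ α → map (joinAtMax m α (suc (k + m))) (Av m)) {xs = Av k} z∈)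
... | α , α∈ , z∈α with ∈-map⁻ (joinAtMax m α (suc (k + m))) z∈α
... | β , β∈ , z≡ = α , β , α∈ , β∈ , z≡

∈-joins⁺ : ∀ {n k z} → k ≤ n → z ∈ joinsOfSizes k (n ∸ k) → z ∈ joins n
∈-joins⁺ {n} k≤n z∈ = ∈-concatMap⁺ (λ k → joinsOfSizes k (n ∸ k)) {xs = upTo (suc n)}
  (Any.map (λ { refl → z∈ }) (∈-upTo⁺ (s≤s k≤n)))

∈-joins⁻ : ∀ {n z} → z ∈ joins n → Σ ℕ λ k → k ≤ n × z ∈ joinsOfSizes k (n ∸ k)
∈-joins⁻ {n} z∈ with find (∈-concatMap⁻ (λ k → joinsOfSizes k (n ∸ k)) {xs = upTo (suc n)} z∈)
... | k , k∈ , z∈k = k , s≤s⁻¹ (∈-upTo⁻ k∈) , z∈k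

-- Cut a 132-avoider at its maximum; the left block, shifted down by the size of the right block, is again an avoider.
∈-Av-suc⇒∈-joins : ∀ n {z} → z ∈ Av (suc n) → z ∈ joins n
∈-Av-suc⇒∈-joins n {z} z∈ with ∈-Av⁻ (suc n) z∈
... | P , avoids with ∈-∃++ (occ≡suc⇒∈ z (IsPermOf.occ≡1 P (suc n) (s≤s z≤n) ≤-refl))
... | x , y , refl = ∈-joins⁺ k≤n (subst (λ j → x ++ N ∷ y ∈ joinsOfSizes k j) (sym n∸k≡m) x++N∷y∈)
  where
  N = suc n
  P′ : IsPermOf n (x ++ y)
  P′ = IsPermOf-remove-max n x y P
  Py×y<x : IsPermOf (length y) y × All (length y <_) x
  Py×y<x = IsPermOf-stacked-suffix n P′ (avoider-stacked n x y P avoids)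
  k = length x
  m = length y
  k+m≡n : k + m ≡ n
  k+m≡n = trans (sym (length-++ x)) (IsPermOf.length≡ P′)
  k≤n : k ≤ n
  k≤n = subst (k ≤_) k+m≡n (m≤m+n k m)
  n∸k≡m : n ∸ k ≡ m
  n∸k≡m = trans (cong (_∸ k) (sym k+m≡n)) (m+n∸m≡n k m)
  α = map (_∸ m) x
  α↑≡x : map (_+ m) α ≡ x
  α↑≡x = shift-unshift m x (proj₂ Py×y<x)
  α-avoids : copies p132 α ≡ 0
  α-avoids = n≤0⇒n≡0 (subst (_≤ 0) (trans (cong (copies p132) (sym α↑≡x)) (copies-shiftʳ m p132 α))
                                    (subst (copies p132 x ≤_) avoids (copies-++-≥ˡ p132 x (N ∷ y))))
  y-avoids : copies p132 y ≡ 0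
  y-avoids = n≤0⇒n≡0 (subst (copies p132 y ≤_) (trans (cong (copies p132) (++-assoc x (N ∷ []) y)) avoids)
                                              (copies-++-≥ʳ p132 (x ++ N ∷ []) y))
  x++N∷y∈ : x ++ N ∷ y ∈ joinsOfSizes k m
  x++N∷y∈ = subst₂ (λ x N → x ++ N ∷ y ∈ joinsOfSizes k m) α↑≡x (cong suc k+m≡n)
              (∈-joinsOfSizes⁺ (∈-Av⁺ k (IsPermOf-unshift n x y P′ (proj₁ Py×y<x) (proj₂ Py×y<x)) α-avoids)
                               (∈-Av⁺ m (proj₁ Py×y<x) y-avoids))

∈-joins⇒∈-Av-suc : ∀ n {z} → z ∈ joins n → z ∈ Av (suc n)
∈-joins⇒∈-Av-suc n z∈ with ∈-joins⁻ z∈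
... | k , k≤n , z∈k with ∈-joinsOfSizes⁻ {k} {n ∸ k} z∈k
... | α , β , α∈ , β∈ , refl with ∈-Av⁻ k α∈ | ∈-Av⁻ (n ∸ k) β∈
... | Pα , α-avoids | Pβ , β-avoids =
  subst (λ j → joinAtMax (n ∸ k) α (suc (k + (n ∸ k))) β ∈ Av (suc j)) (m+[n∸m]≡n k≤n)
    (∈-Av⁺ (suc (k + (n ∸ k))) (joinAtMax-IsPermOf k (n ∸ k) Pα Pβ)
      (joinAtMax-avoids k (n ∸ k) (IsPermOf.bounded Pα) (All.map proj₂ (IsPermOf.bounded Pβ)) α-avoids β-avoids))

++-∷-cancel-below : ∀ {N} x x′ {y y′ : List ℕ} → All (_< N) x → All (_< N) x′ →
  x ++ N ∷ y ≡ x′ ++ N ∷ y′ → x ≡ x′ × y ≡ y′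
++-∷-cancel-below [] [] _ _ e = refl , ∷-injectiveʳ e
++-∷-cancel-below [] (_ ∷ _) _ (a<N ∷ _) e = ⊥-elim (<-irrefl (sym (∷-injectiveˡ e)) a<N)
++-∷-cancel-below (_ ∷ _) [] (a<N ∷ _) _ e = ⊥-elim (<-irrefl (∷-injectiveˡ e) a<N)
++-∷-cancel-below (a ∷ x) (a′ ∷ x′) (_ ∷ x<N) (_ ∷ x′<N) e =
  let (x≡x′ , y≡y′) = ++-∷-cancel-below x x′ x<N x′<N (∷-injectiveʳ e) in cong₂ _∷_ (∷-injectiveˡ e) x≡x′ , y≡y′

Unique-joinsOfSizes : ∀ k m → Unique (joinsOfSizes k m)
Unique-joinsOfSizes k m = Unique-concatMap (λ α → map (joinAtMax m α N) (Av m)) (Unique-Av k)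
  (λ _ → Unique.map⁺ (λ e → ∷-injectiveʳ (++-cancelˡ _ _ _ e)) (Unique-Av m)) disjoint
  where
  N = suc (k + m)
  disjoint : ∀ {α α′ z} → α ∈ Av k → α′ ∈ Av k →
    z ∈ map (joinAtMax m α N) (Av m) → z ∈ map (joinAtMax m α′ N) (Av m) → α ≡ α′
  disjoint {α} {α′} α∈ α′∈ z∈ z∈′ with ∈-map⁻ (joinAtMax m α N) z∈ | ∈-map⁻ (joinAtMax m α′ N) z∈′
  ... | _ , _ , refl | _ , _ , e = map-injective (+-cancelʳ-≡ m _ _)
    (proj₁ (++-∷-cancel-below _ _ (shifted-below m (bounded α∈)) (shifted-below m (bounded α′∈)) e))
    where
    bounded : ∀ {α} → α ∈ Av k → Bounded k α
    bounded α∈ = IsPermOf.bounded (proj₁ (∈-Av⁻ k α∈))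

Unique-joins : ∀ n → Unique (joins n)
Unique-joins n = Unique-concatMap (λ k → joinsOfSizes k (n ∸ k)) (Unique.upTo⁺ (suc n)) (λ {k} _ → Unique-joinsOfSizes k (n ∸ k)) disjoint
  where
  disjoint : ∀ {k k′ z} → k ∈ upTo (suc n) → k′ ∈ upTo (suc n) →
    z ∈ joinsOfSizes k (n ∸ k) → z ∈ joinsOfSizes k′ (n ∸ k′) → k ≡ k′
  disjoint {k} {k′} k∈ k′∈ z∈ z∈′ with ∈-joinsOfSizes⁻ {k} {n ∸ k} z∈ | ∈-joinsOfSizes⁻ {k′} {n ∸ k′} z∈′
  ... | α , β , α∈ , _ , refl | α′ , β′ , α′∈ , _ , e = begin
    k                           ≡⟨ sym (length≡ α∈) ⟩
    length α                    ≡⟨ sym (length-map (_+ (n ∸ k)) α) ⟩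
    length (map (_+ (n ∸ k)) α)  ≡⟨ cong length prefixes-agree ⟩
    length (map (_+ (n ∸ k′)) α′) ≡⟨ length-map (_+ (n ∸ k′)) α′ ⟩
    length α′                   ≡⟨ length≡ α′∈ ⟩
    k′                          ∎
    where
    open ≡-Reasoning
    length≡ : ∀ {j α} → α ∈ Av j → length α ≡ j
    length≡ {j} α∈ = IsPermOf.length≡ (proj₁ (∈-Av⁻ j α∈))
    below-max : ∀ {j α} → j ∈ upTo (suc n) → α ∈ Av j → All (_< suc n) (map (_+ (n ∸ j)) α)
    below-max {j} {α} j∈ α∈ = subst (λ N → All (_< suc N) (map (_+ (n ∸ j)) α)) (m+[n∸m]≡n (s≤s⁻¹ (∈-upTo⁻ j∈)))
                            (shifted-below (n ∸ j) (IsPermOf.bounded (proj₁ (∈-Av⁻ j α∈))))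
    prefixes-agree : map (_+ (n ∸ k)) α ≡ map (_+ (n ∸ k′)) α′
    prefixes-agree = proj₁ (++-∷-cancel-below _ _ (below-max k∈ α∈) (below-max k′∈ α′∈)
                       (subst₂ (λ N N′ → map (_+ (n ∸ k)) α ++ suc N ∷ β ≡ map (_+ (n ∸ k′)) α′ ++ suc N′ ∷ β′)
                               (m+[n∸m]≡n (s≤s⁻¹ (∈-upTo⁻ k∈))) (m+[n∸m]≡n (s≤s⁻¹ (∈-upTo⁻ k′∈))) e))

-- A 132-avoider of size n + 1 is (α ⊖ β) with its maximum inserted between the two blocks.
counts-suc : ∀ n σ → counts σ (suc n) ≡ ∑ (splits σ) (stackedAbove (λ (L , R) → (counts⊕₁ L ⋆ counts R) n))
counts-suc n σ = trans (∑-unique-⇔ (copies σ) (Unique-Av (suc n)) (Unique-joins n)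
                          (mk⇔ (∈-Av-suc⇒∈-joins n) (∈-joins⇒∈-Av-suc n)))
                       (∑-joins n σ)

-- Patterns ending in their maximum

allStacked-[]ʳ : ∀ up L → allStacked up L [] ≡ true
allStacked-[]ʳ up [] = refl
allStacked-[]ʳ up (_ ∷ L) = allStacked-[]ʳ up L

allStacked-++ˡ : ∀ up P L R → allStacked up (P ++ L) R ≡ allStacked up P R ∧ allStacked up L R
allStacked-++ˡ up P L R = all-++ (λ x → all (stacked up x) R) P L

allStacked-above-blocked : ∀ {x z} L {R} → x < z → z ∈ R → allStacked true (x ∷ L) R ≡ false
allStacked-above-blocked {x} {z} L {R} x<z z∈R = cong (_∧ allStacked true L R) (all-false (stacked true x) z∈R x-blocked)
  where
  x-blocked : stacked true x z ≡ false
  x-blocked rewrite <⇒<ᵇ≡true x<z = refl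

allStacked-above : ∀ {P T} → All (λ a → All (_< a) T) P → allStacked true P T ≡ true
allStacked-above [] = refl
allStacked-above {x ∷ P} {T} (T<x ∷ T<P) rewrite allStacked-above T<P = trans (∧-identityʳ _) (all-true⁺ _ (All.map stacked-below T<x))
  where
  stacked-below : ∀ {e} → e < x → stacked true x e ≡ true
  stacked-below e<x rewrite ≥⇒<ᵇ≡false (<⇒≤ e<x) | <⇒<ᵇ≡true e<x = refl

allStacked-below-top : ∀ {σ z} → All (_< z) σ → allStacked false σ (z ∷ []) ≡ true
allStacked-below-top [] = refl
allStacked-below-top {x ∷ σ} {z} (x<z ∷ σ<z) rewrite <⇒<ᵇ≡true x<z | ≥⇒<ᵇ≡false (<⇒≤ x<z) = allStacked-below-top σ<z

allStacked-below-blocked : ∀ {σ z M} → M ∈ σ → z < M → allStacked false σ (z ∷ []) ≡ false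
allStacked-below-blocked {σ} {z} {M} M∈σ z<M = all-false (λ x → all (stacked false x) (z ∷ [])) M∈σ M-blocked
  where
  M-blocked : all (stacked false M) (z ∷ []) ≡ false
  M-blocked rewrite ≥⇒<ᵇ≡false {M} {z} (<⇒≤ z<M) = refl

∑-splits-head-blocked : ∀ σ (g f : List ℕ → List ℕ) G →
  (∀ {x L R} → x ∷ L ++ R ≡ σ → allStacked true (g (x ∷ L)) (f R) ≡ false) →
  ∑ (splits σ) (λ (L , R) → stackedAbove G (g L , f R)) ≡ stackedAbove G (g [] , f σ)
∑-splits-head-blocked σ g f G blocked =
  ∑-splits-head σ _ (λ {x} {L} {R} e → cong (λ b → ⟦ b ⟧ * G (g (x ∷ L) , f R)) (blocked e))

∷-∈ : ∀ {x} {L R σ : List ℕ} → x ∷ L ++ R ≡ σ → x ∈ σ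
∷-∈ refl = here refl

stackedAbove-true : ∀ G {L R} → allStacked true L R ≡ true → stackedAbove G (L , R) ≡ G (L , R)
stackedAbove-true G e rewrite e = +-identityʳ _

-- A nonempty left part cannot be stacked above a right part containing the top entry z.
∑-splits-top : ∀ σ z W G → All (_< z) σ →
  ∑ (splits (σ ++ z ∷ [])) (λ (L , R) → stackedAbove G (L , R ++ W)) ≡
  stackedAbove G ([] , (σ ++ z ∷ []) ++ W) + stackedAbove G (σ ++ z ∷ [] , W)
∑-splits-top σ z W G σ<z =
  trans (∑-splits-∷ʳ (λ (L , R) → stackedAbove G (L , R ++ W)) σ z)
        (cong (_+ stackedAbove G (σ ++ z ∷ [] , W))
          (∑-splits-head-blocked σ id (λ R → (R ++ z ∷ []) ++ W) G (λ {_} {L} {R} e →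
             allStacked-above-blocked L (All.lookup σ<z (∷-∈ {L = L} {R} e)) (∈-++⁺ˡ (∈-++⁺ʳ R (here refl))))))

∑-splits-∷ʳ-top : ∀ σ z G → All (_< z) σ →
  ∑ (splits (σ ++ z ∷ [])) (stackedAbove G) ≡ G ([] , σ ++ z ∷ []) + G (σ ++ z ∷ [] , [])
∑-splits-∷ʳ-top σ z G σ<z = begin
  ∑ (splits (σ ++ z ∷ [])) (stackedAbove G)
    ≡⟨ ∑-cong (splits (σ ++ z ∷ [])) (λ (L , R) → cong (λ R′ → stackedAbove G (L , R′)) (sym (++-identityʳ R))) ⟩
  ∑ (splits (σ ++ z ∷ [])) (λ (L , R) → stackedAbove G (L , R ++ []))
    ≡⟨ ∑-splits-top σ z [] G σ<z ⟩
  stackedAbove G ([] , (σ ++ z ∷ []) ++ []) + stackedAbove G (σ ++ z ∷ [] , [])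
    ≡⟨ cong₂ _+_ (trans (cong (λ R → stackedAbove G ([] , R)) (++-identityʳ _)) (stackedAbove-true G refl))
                 (stackedAbove-true G (allStacked-[]ʳ true (σ ++ z ∷ []))) ⟩
  G ([] , σ ++ z ∷ []) + G (σ ++ z ∷ [] , [])
    ∎
  where open ≡-Reasoning

-- A proper nonempty left part of X lies below M, and a left part reaching into Y′ lies below z.
∑-splits-skew : ∀ X′ M Y′ z G → All (_< M) X′ → All (_< z) Y′ →
  let X = X′ ++ M ∷ [] ; Y = Y′ ++ z ∷ [] in
  allStacked true X Y ≡ true →
  ∑ (splits (X ++ Y)) (stackedAbove G) ≡ G ([] , X ++ Y) + G (X , Y) + G (X ++ Y , [])
∑-splits-skew X′ M Y′ z G X′<M Y′<z X-above-Y = +-cancelʳ-≡ (h (X , Y)) _ _ (begin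
  ∑ (splits (X ++ Y)) h + h (X , Y)
    ≡⟨ ∑-splits-++ h X Y ⟩
  ∑ (splits X) (λ (L , R) → h (L , R ++ Y)) + ∑ (splits Y) (λ (L , R) → h (X ++ L , R))
    ≡⟨ cong₂ _+_ (∑-splits-top X′ M Y G X′<M) inside-Y ⟩
  h ([] , X ++ Y) + h (X , Y) + (h (X , Y) + h (X ++ Y , []))
    ≡⟨ cong₂ (λ a b → a + h (X , Y) + (h (X , Y) + b))
             (stackedAbove-true G refl) (stackedAbove-true G (allStacked-[]ʳ true (X ++ Y))) ⟩
  G ([] , X ++ Y) + h (X , Y) + (h (X , Y) + G (X ++ Y , []))
    ≡⟨ lemma (G ([] , X ++ Y)) (h (X , Y)) (G (X ++ Y , [])) ⟩
  G ([] , X ++ Y) + h (X , Y) + G (X ++ Y , []) + h (X , Y)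
    ≡⟨ cong (λ b → G ([] , X ++ Y) + b + G (X ++ Y , []) + h (X , Y)) (stackedAbove-true G X-above-Y) ⟩
  G ([] , X ++ Y) + G (X , Y) + G (X ++ Y , []) + h (X , Y)
    ∎)
  where
  open ≡-Reasoning
  X = X′ ++ M ∷ []
  Y = Y′ ++ z ∷ []
  h : List ℕ × List ℕ → ℕ
  h = stackedAbove G
  lemma : ∀ a b c → a + b + (b + c) ≡ a + b + c + b
  lemma = solve-∀
  inside-Y : ∑ (splits Y) (λ (L , R) → h (X ++ L , R)) ≡ h (X , Y) + h (X ++ Y , [])
  inside-Y = trans (∑-splits-∷ʳ (λ (L , R) → h (X ++ L , R)) Y′ z)
    (cong (_+ h (X ++ Y , [])) (trans
      (∑-splits-head-blocked Y′ (X ++_) (_++ z ∷ []) G (λ {_} {L} {R} e →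
         trans (allStacked-++ˡ true X _ (R ++ z ∷ []))
               (trans (cong (allStacked true X (R ++ z ∷ []) ∧_)
                            (allStacked-above-blocked L (All.lookup Y′<z (∷-∈ {L = L} {R} e)) (∈-++⁺ʳ R (here refl))))
                      (∧-zeroʳ _))))
      (cong (λ L → h (L , Y)) (++-identityʳ X))))

counts-shift : ∀ c σ → counts (map (_+ c) σ) ≗ counts σ
counts-shift c σ k = ∑-cong (Av k) (copies-shiftˡ c σ)

counts-++ˡ-zero : ∀ u {v} → counts v 0 ≡ 0 → counts (u ++ v) 0 ≡ 0
counts-++ˡ-zero [] v₀ = v₀
counts-++ˡ-zero (_ ∷ _) _ = refl

counts⊕₁-[] : counts⊕₁ [] ≗ counts []
counts⊕₁-[] k = trans (+-identityʳ _) (trans (*-identityʳ _) (*-identityˡ _))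

counts⊕₁-∷ʳ : ∀ σ z k → counts⊕₁ (σ ++ z ∷ []) k ≡ ⟦ allStacked false σ (z ∷ []) ⟧ * counts σ k + counts (σ ++ z ∷ []) k
counts⊕₁-∷ʳ σ z k = begin
  counts⊕₁ (σ ++ z ∷ []) k
    ≡⟨ ∑-splits-∷ʳ term σ z ⟩
  ∑ (splits σ) (λ (L₁ , L₂) → term (L₁ , L₂ ++ z ∷ [])) + term (σ ++ z ∷ [] , [])
    ≡⟨ cong₂ _+_ (∑-splits-last σ _ (λ {L₁} {x} {L₂} _ → vanish L₁ x L₂))
                 (cong (λ b → ⟦ b ⟧ * counts (σ ++ z ∷ []) k * 1) (allStacked-[]ʳ false (σ ++ z ∷ []))) ⟩
  ⟦ allStacked false σ (z ∷ []) ⟧ * counts σ k * 1 + 1 * counts (σ ++ z ∷ []) k * 1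
    ≡⟨ cong₂ _+_ (*-identityʳ (⟦ allStacked false σ (z ∷ []) ⟧ * counts σ k))
                 (trans (*-identityʳ (1 * counts (σ ++ z ∷ []) k)) (*-identityˡ (counts (σ ++ z ∷ []) k))) ⟩
  ⟦ allStacked false σ (z ∷ []) ⟧ * counts σ k + counts (σ ++ z ∷ []) k
    ∎
  where
  open ≡-Reasoning
  term : List ℕ × List ℕ → ℕ
  term (L₁ , L₂) = ⟦ allStacked false L₁ L₂ ⟧ * counts L₁ k * atMostOne L₂
  long : ∀ x L₂ → atMostOne (x ∷ L₂ ++ z ∷ []) ≡ 0
  long x [] = refl
  long x (_ ∷ _) = refl
  vanish : ∀ L₁ x L₂ → term (L₁ , x ∷ L₂ ++ z ∷ []) ≡ 0
  vanish L₁ x L₂ rewrite long x L₂ = *-zeroʳ (⟦ allStacked false L₁ (x ∷ L₂ ++ z ∷ []) ⟧ * counts L₁ k)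

counts⊕₁-top : ∀ σ z → All (_< z) σ → counts⊕₁ (σ ++ z ∷ []) ≗ counts (σ ++ z ∷ []) ⊞ counts σ
counts⊕₁-top σ z σ<z k rewrite counts⊕₁-∷ʳ σ z k | allStacked-below-top σ<z =
  trans (cong (_+ counts (σ ++ z ∷ []) k) (+-identityʳ _)) (+-comm (counts σ k) _)

counts⊕₁-below-blocked : ∀ σ z {M} → M ∈ σ → z < M → counts⊕₁ (σ ++ z ∷ []) ≗ counts (σ ++ z ∷ [])
counts⊕₁-below-blocked σ z M∈ z<M k rewrite counts⊕₁-∷ʳ σ z k | allStacked-below-blocked M∈ z<M = refl

open Recurrence (counts [])

counts-∷ʳ-top-Solves : ∀ σ z → All (_< z) σ → Solves (counts (σ ++ z ∷ [])) (shift (counts σ ⋆ counts []))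
counts-∷ʳ-top-Solves σ z σ<z = solves (counts-++ˡ-zero σ refl) λ n → begin
  X (suc n)
    ≡⟨ counts-suc n (σ ++ z ∷ []) ⟩
  ∑ (splits (σ ++ z ∷ [])) (stackedAbove (λ (L , R) → (counts⊕₁ L ⋆ counts R) n))
    ≡⟨ ∑-splits-∷ʳ-top σ z _ σ<z ⟩
  (counts⊕₁ [] ⋆ X) n + (counts⊕₁ (σ ++ z ∷ []) ⋆ c) n
    ≡⟨ cong₂ _+_ (⋆-congˡ X counts⊕₁-[] n) (trans (⋆-congˡ c (counts⊕₁-top σ z σ<z) n) (⋆-distribʳ-⊞ X (counts σ) c n)) ⟩
  (c ⋆ X) n + ((X ⋆ c) n + (counts σ ⋆ c) n)
    ≡⟨ sym (+-assoc ((c ⋆ X) n) _ _) ⟩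
  (c ⋆ X) n + (X ⋆ c) n + (counts σ ⋆ c) n
    ≡⟨ cong (_+ (counts σ ⋆ c) n) (+-comm ((c ⋆ X) n) _) ⟩
  (X ⋆ c) n + (c ⋆ X) n + (counts σ ⋆ c) n
    ∎
  where
  open ≡-Reasoning
  X = counts (σ ++ z ∷ [])
  c = counts []

counts-skew-Solves : ∀ X′ M Y′ z → All (_< M) X′ → All (_< z) Y′ →
  let X = X′ ++ M ∷ [] ; Y = Y′ ++ z ∷ [] in
  All (λ a → All (_< a) Y) X →
  Solves (counts (X ++ Y)) (shift ((counts X ⊞ counts X′) ⋆ counts Y))
counts-skew-Solves X′ M Y′ z X′<M Y′<z Y<X = solves (counts-++ˡ-zero X (counts-++ˡ-zero Y′ refl)) λ n → begin
  XY (suc n)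
    ≡⟨ counts-suc n (X ++ Y) ⟩
  ∑ (splits (X ++ Y)) (stackedAbove (λ (L , R) → (counts⊕₁ L ⋆ counts R) n))
    ≡⟨ ∑-splits-skew X′ M Y′ z _ X′<M Y′<z (allStacked-above Y<X) ⟩
  (counts⊕₁ [] ⋆ XY) n + (counts⊕₁ X ⋆ counts Y) n + (counts⊕₁ (X ++ Y) ⋆ c) n
    ≡⟨ cong₂ _+_ (cong₂ _+_ (⋆-congˡ XY counts⊕₁-[] n) (⋆-congˡ (counts Y) (counts⊕₁-top X′ M X′<M) n))
                 (⋆-congˡ c XY-blocked n) ⟩
  (c ⋆ XY) n + ((counts X ⊞ counts X′) ⋆ counts Y) n + (XY ⋆ c) n
    ≡⟨ lemma ((c ⋆ XY) n) _ ((XY ⋆ c) n) ⟩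
  (XY ⋆ c) n + (c ⋆ XY) n + ((counts X ⊞ counts X′) ⋆ counts Y) n
    ∎
  where
  open ≡-Reasoning
  X = X′ ++ M ∷ []
  Y = Y′ ++ z ∷ []
  XY = counts (X ++ Y)
  c = counts []
  XY-blocked : counts⊕₁ (X ++ Y) ≗ XY
  XY-blocked k = begin
    counts⊕₁ (X ++ Y) k                     ≡⟨ cong (λ σ → counts⊕₁ σ k) (sym (++-assoc X Y′ (z ∷ []))) ⟩
    counts⊕₁ ((X ++ Y′) ++ z ∷ []) k        ≡⟨ counts⊕₁-below-blocked (X ++ Y′) z (∈-++⁺ˡ (∈-++⁺ʳ X′ (here refl)))
                                                  (All.lookup (All.lookup Y<X (∈-++⁺ʳ X′ (here refl))) (∈-++⁺ʳ Y′ (here refl))) k ⟩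
    counts ((X ++ Y′) ++ z ∷ []) k          ≡⟨ cong (λ σ → counts σ k) (++-assoc X Y′ (z ∷ [])) ⟩
    XY k                                     ∎
  lemma : ∀ a b d → a + b + d ≡ d + a + b
  lemma = solve-∀

-- Skew sums and increasing tails

oneTo-suc : ∀ w → oneTo (suc w) ≡ oneTo w ++ suc w ∷ []
oneTo-suc w = trans (cong (map suc) (sym (applyUpTo-∷ʳ id w))) (map-++ suc (upTo w) (w ∷ []))

⊕-inc-suc : ∀ X w → X ⊕ inc (suc w) ≡ (X ⊕ inc w) ++ suc w + length X ∷ []
⊕-inc-suc X w = begin
  X ++ map (_+ length X) (oneTo (suc w))                         ≡⟨ cong (λ l → X ++ map (_+ length X) l) (oneTo-suc w) ⟩
  X ++ map (_+ length X) (oneTo w ++ suc w ∷ [])                 ≡⟨ cong (X ++_) (map-++ (_+ length X) (oneTo w) (suc w ∷ [])) ⟩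
  X ++ (map (_+ length X) (oneTo w) ++ suc w + length X ∷ [])    ≡⟨ sym (++-assoc X _ _) ⟩
  (X ⊕ inc w) ++ suc w + length X ∷ []                           ∎
  where open ≡-Reasoning

⊕-inc-below : ∀ X w → All (_≤ length X) X → All (_< suc w + length X) (X ⊕ inc w)
⊕-inc-below X w X≤ = All.++⁺ (All.map (λ a≤ → s≤s (≤-trans a≤ (m≤n+m (length X) w))) X≤)
  (All.map⁺ (All.tabulate λ j∈ → +-monoˡ-< (length X) (s≤s (proj₂ (∈-oneTo⁻ j∈)))))

⊕-inc-positive : ∀ X w → All (1 ≤_) X → All (1 ≤_) (X ⊕ inc w)
⊕-inc-positive X w X≥1 = All.++⁺ X≥1 (All.map⁺ (All.tabulate λ {j} j∈ → ≤-trans (proj₁ (∈-oneTo⁻ j∈)) (m≤m+n j (length X))))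

Solves-counts-≡ : ∀ {σ σ′ Z} → σ ≡ σ′ → Solves (counts σ) Z → Solves (counts σ′) Z
Solves-counts-≡ refl s = s

⊖-bounded : ∀ q t → All (_≤ length q) q → All (_≤ length t) t → All (_≤ length (q ⊖ t)) (q ⊖ t)
⊖-bounded q t q≤ t≤ = subst (λ l → All (_≤ l) (q ⊖ t)) (sym (trans (length-++ (map (_+ length t) q)) (cong (_+ length t) (length-map _ q))))
  (All.++⁺ (All.map⁺ (All.map (+-monoˡ-≤ (length t)) q≤)) (All.map (λ b≤ → ≤-trans b≤ (m≤n+m (length t) (length q))) t≤))

counts-⊖-Solves : ∀ σ′ z t t′ → t ≡ t′ ++ length t ∷ [] → All (_< length t) t′ →
  All (_< z) σ′ → All (1 ≤_) (σ′ ++ z ∷ []) →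
  Solves (counts ((σ′ ++ z ∷ []) ⊖ t)) (shift ((counts (σ′ ++ z ∷ []) ⊞ counts σ′) ⋆ counts t))
counts-⊖-Solves σ′ z t t′ t≡ t′<nt σ′<z σ≥1 =
  Solves-respʳ (shift-cong (⋆-cong unshift-drivers (λ k → cong (λ σ → counts σ k) (sym t≡))))
    (Solves-counts-≡ skew≡ (counts-skew-Solves (map (_+ nt) σ′) (z + nt) t′ nt
      (All.map⁺ (All.map (+-monoˡ-< nt) σ′<z)) t′<nt (subst (All (λ a → All (_< a) (t′ ++ nt ∷ []))) (map-++ (_+ nt) σ′ (z ∷ []))
                                                        (All.map⁺ (All.map above-t σ≥1)))))
  where
  nt = length t
  above-t : ∀ {a} → 1 ≤ a → All (_< a + nt) (t′ ++ nt ∷ [])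
  above-t 1≤a = All.map (λ b≤nt → ≤-<-trans b≤nt (m<n+m nt 1≤a)) (All.++⁺ (All.map <⇒≤ t′<nt) (≤-refl ∷ []))
  unshift-drivers : counts (map (_+ nt) σ′ ++ z + nt ∷ []) ⊞ counts (map (_+ nt) σ′) ≗ counts (σ′ ++ z ∷ []) ⊞ counts σ′
  unshift-drivers k = cong₂ _+_ (trans (cong (λ σ → counts σ k) (sym (map-++ (_+ nt) σ′ (z ∷ [])))) (counts-shift nt (σ′ ++ z ∷ []) k))
                                (counts-shift nt σ′ k)
  skew≡ : (map (_+ nt) σ′ ++ z + nt ∷ []) ++ (t′ ++ nt ∷ []) ≡ (σ′ ++ z ∷ []) ⊖ t
  skew≡ = cong₂ _++_ (sym (map-++ (_+ nt) σ′ (z ∷ []))) (sym t≡)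

-- g 0 = counts q′ and g (w + 1) = counts (q ⊕ inc w) drive both a w = counts ((q ⊖ t) ⊕ inc w)
-- and b w = counts ((q ⊕ inc w) ⊖ t) in the recurrences of `solutions-agree`.
⊖-⊕-inc-counts : ∀ q q′ t t′ → q ≡ q′ ++ length q ∷ [] → t ≡ t′ ++ length t ∷ [] →
  All (_< length q) q′ → All (_< length t) t′ → Bounded (length q) q → Bounded (length t) t →
  ∀ u → counts ((q ⊖ t) ⊕ inc u) ≗ counts ((q ⊕ inc u) ⊖ t)
⊖-⊕-inc-counts q q′ t t′ q≡ t≡ q′<nq t′<nt q-bnd t-bnd =
  solutions-agree (counts t) (counts ∘ init) (λ w → counts (Z ⊕ inc w)) (λ w → counts ((q ⊕ inc w) ⊖ t))
    G-solves B-solves A-solves a₀≗b₀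
  where
  Z = q ⊖ t
  init : ℕ → List ℕ
  init zero = q′
  init (suc w) = q ⊕ inc w
  top : ℕ → ℕ
  top zero = length q
  top (suc w) = suc w + length q
  init-top : ∀ w → q ⊕ inc w ≡ init w ++ top w ∷ []
  init-top zero = trans (++-identityʳ q) q≡
  init-top (suc w) = ⊕-inc-suc q w
  init<top : ∀ w → All (_< top w) (init w)
  init<top zero = q′<nq
  init<top (suc w) = ⊕-inc-below q w (All.map proj₂ q-bnd)
  G-solves : ∀ w → Solves (counts (init (suc w))) (shift (counts (init w) ⋆ counts []))
  G-solves w = Solves-counts-≡ (sym (init-top w)) (counts-∷ʳ-top-Solves (init w) (top w) (init<top w))
  B-solves : ∀ w → Solves (counts ((q ⊕ inc w) ⊖ t)) (shift ((counts (init (suc w)) ⊞ counts (init w)) ⋆ counts t))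
  B-solves w = subst (λ σ → Solves (counts (σ ⊖ t)) (shift ((counts σ ⊞ counts (init w)) ⋆ counts t))) (sym (init-top w))
    (counts-⊖-Solves (init w) (top w) t t′ t≡ t′<nt (init<top w)
      (subst (All (1 ≤_)) (init-top w) (⊕-inc-positive q w (All.map proj₁ q-bnd))))
  A-solves : ∀ w → Solves (counts (Z ⊕ inc (suc w))) (shift (counts (Z ⊕ inc w) ⋆ counts []))
  A-solves w = Solves-counts-≡ (sym (⊕-inc-suc Z w))
    (counts-∷ʳ-top-Solves (Z ⊕ inc w) (suc w + length Z) (⊕-inc-below Z w (⊖-bounded q t (All.map proj₂ q-bnd) (All.map proj₂ t-bnd))))
  a₀≗b₀ : counts (Z ⊕ inc 0) ≗ counts ((q ⊕ inc 0) ⊖ t)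
  a₀≗b₀ k = cong (λ σ → counts σ k) (trans (++-identityʳ Z) (cong (λ σ → map (_+ length t) σ ++ t) (sym (++-identityʳ q))))

mainTheorem3 : (q t : List ℕ) (u n : ℕ) →
    IsPerm q → q ≢ [] → EndsInMax q →
    IsPerm t → t ≢ [] → EndsInMax t →
    1 ≤ u → 1 ≤ n →
    S n p132 ((q ⊖ t) ⊕ inc u) ≡ S n p132 ((q ⊕ inc u) ⊖ t)
mainTheorem3 q t u n isPerm-q _ ends-q isPerm-t _ ends-t _ _
  with EndsInMax⇒∷ʳ q isPerm-q ends-q | EndsInMax⇒∷ʳ t isPerm-t ends-t
... | q′ , q≡ , q′<nq | t′ , t≡ , t′<nt =
  ⊖-⊕-inc-counts q q′ t t′ q≡ t≡ q′<nq t′<nt (IsPerm⇒Bounded q isPerm-q) (IsPerm⇒Bounded t isPerm-t) u n
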